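{- Let $L\ge 1$ and $1\le m\le 2^L$ be integers, let $(\beta_1,\dots,\beta_{2^L})$ be a Cantor basis of ${\rm GF}(2^{2^L})$ over ${\rm GF}(2)$, and let $W_i$, $\varpi_u$ be as in the context. There is an algorithm (the evaluation algorithm) which, given $a\in W_{2^L}\setminus W_m$ and a polynomial $f$ over ${\rm GF}(2^{2^L})$ of degree $<2^m$, outputs $(v_0,\dots,v_{2^m-1})$ with $v_i=f(a+\varpi_i)$, and which uses no more than $2^m m(1+\log_2 m)$ additions in ${\rm GF}(2^{2^L})$.
   Context: A Cantor basis of ${\rm GF}(2^{2^L})$ over ${\rm GF}(2)$ is a ${\rm GF}(2)$-basis $(\beta_1,\dots,\beta_{2^L})$ with $\beta_1=1$ and $\beta_i^2-\beta_i=\beta_{i-1}$ for $i>1$. $W_i=\sum_{t=1}^i{\rm GF}(2)\beta_t$. For $0\le u<2^{2^L}$ with binary digits $u=\sum_t u_t2^t$, $\varpi_u=\sum_t u_t\beta_{t+1}$. -}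

module Defs where

open import Level using (0ℓ)
open import Data.Nat as ℕ using (ℕ; zero; suc; _∸_; _^_; _<_; _≤_; _/_; _%_)
import Relation.Nullary
open import Data.Bool using (Bool; true; false; if_then_else_)
open import Data.Fin using (Fin; toℕ)
open import Data.List using (List; []; _∷_; _++_; length; lookup)
open import Data.Maybe using (Maybe; just; nothing)
open import Data.Product using (Σ; ∃; _×_; _,_)
open import Relation.Nullary using (¬_)
open import Relation.Binary.PropositionalEquality using (_≡_)
open import Algebra.Bundles using (CommutativeRing)

module _ (R : CommutativeRing 0ℓ 0ℓ) where
  open CommutativeRing R renaming (Carrier to K)

  IsField : Set
  IsField = (¬ (1# ≈ 0#)) × (∀ x → ¬ (x ≈ 0#) → ∃ λ y → x * y ≈ 1#)

  Char2 : Set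
  Char2 = 1# + 1# ≈ 0#

  sumTo : ℕ → (ℕ → K) → K
  sumTo zero    g = 0#
  sumTo (suc n) g = sumTo n g + g n

  scal : Bool → K → K
  scal b x = if b then x else 0#

  comb : ℕ → (ℕ → Bool) → (ℕ → K) → K
  comb n c β = sumTo n (λ t → scal (c t) (β t))

  IsBasis : ℕ → (ℕ → K) → Set
  IsBasis n β =
    (∀ x → ∃ λ c → x ≈ comb n c β) ×
    (∀ c → comb n c β ≈ 0# → ∀ t → t < n → c t ≡ false)

  -- Cantor basis (0-indexed: β 0 is the paper's β₁):
  -- β 0 = 1 and β (t+1)^2 - β (t+1) = β t for t+1 < n
  IsCantorBasis : ℕ → (ℕ → K) → Set
  IsCantorBasis n β =
    IsBasis n β × (β 0 ≈ 1#) ×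
    (∀ t → suc t < n → (β (suc t) * β (suc t)) - β (suc t) ≈ β t)

  -- W_i = span of the first i basis elements (paper's β₁ … β_i)
  InW : (ℕ → K) → ℕ → K → Set
  InW β i x = ∃ λ c → x ≈ comb i c β

  bit : ℕ → ℕ → Bool
  bit u zero with u % 2
  ... | zero  = false
  ... | suc _ = true
  bit u (suc t) = bit (u / 2) t

  -- ϖ_u = Σ_t u_t β_{t+1} (paper indexing) = Σ_{t<n} u_t β t (ours)
  varpi : ℕ → (ℕ → K) → ℕ → K
  varpi n β u = comb n (bit u) β

  _^K_ : K → ℕ → K
  x ^K zero  = 1#
  x ^K suc k = (x ^K k) * x

  evalPoly : (N : ℕ) → (Fin N → K) → K → K
  evalPoly N f x = sumTo N (λ j → coeff j * (x ^K j))
    where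
    coeff : ℕ → K
    coeff j with j ℕ.<? N
    ... | Relation.Nullary.yes p = f (Data.Fin.fromℕ< p)
    ... | Relation.Nullary.no _ = 0#

  -- Algebraic straight-line programs over R with N inputs.
  -- Register k holds the value of the k-th instruction.
  data Instr (N : ℕ) : Set where
    inp   : Fin N → Instr N
    const : K → Instr N
    add   : ℕ → ℕ → Instr N
    sub   : ℕ → ℕ → Instr N
    mul   : ℕ → ℕ → Instr N

  reg : List K → ℕ → K
  reg []       _       = 0#
  reg (x ∷ _)  zero    = x
  reg (_ ∷ xs) (suc k) = reg xs k

  step : ∀ {N} → (Fin N → K) → List K → Instr N → K
  step f rs (inp j)   = f j
  step f rs (const k) = k
  step f rs (add i j) = reg rs i + reg rs j
  step f rs (sub i j) = reg rs i - reg rs j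
  step f rs (mul i j) = reg rs i * reg rs j

  runFrom : ∀ {N} → (Fin N → K) → List K → List (Instr N) → List K
  runFrom f rs []       = rs
  runFrom f rs (c ∷ cs) = runFrom f (rs ++ (step f rs c ∷ [])) cs

  run : ∀ {N} → List (Instr N) → (Fin N → K) → List K
  run P f = runFrom f [] P

  additions : ∀ {N} → List (Instr N) → ℕ
  additions []            = 0
  additions (add _ _ ∷ P) = suc (additions P)
  additions (sub _ _ ∷ P) = suc (additions P)
  additions (_ ∷ P)       = additions P

-- A ≤ 2^m · m · (1 + log₂ m)   (real logarithm), stated without reals:
-- for m ≥ 1 it is equivalent to 2^(A ∸ 2^m·m) ≤ m^(2^m·m).
AtMostFFTBound : ℕ → ℕ → Set
AtMostFFTBound m A = 2 ^ (A ∸ (2 ^ m) ℕ.* m) ≤ m ^ ((2 ^ m) ℕ.* m)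

module Submission where

-- σ_r(X) = X^(2^(2^r)) + X is GF(2)-linear, kills W_{2^r} and maps β_{u+2^r} to β_u, so it maps the coset
-- a + ϖ_{hi·2^(2^r)} + W_{2^r} to the single point σ_r(a) + ϖ_hi.  Dividing repeatedly by powers
-- σ_r^D = X^(2^(2^r)·D) + X^D, which costs only additions, writes f = Σ_i g_i · σ_r^i with deg g_i < 2^(2^r).
-- For 2^r < m ≤ 2^(r+1), evaluating f on a + W_m then splits into two families of smaller evaluations of the
-- same kind: for each coefficient position j the polynomial Σ_i g_{i,j} Y^i on σ_r(a) + W_(m−2^r), and for
-- each hi the resulting polynomial of degree < 2^(2^r) on a + ϖ_{hi·2^(2^r)} + W_{2^r}.  Counting additions
-- by induction on r gives 2A ≤ 2^m·m·(2 + r), and choosing 2^r < 2m turns this into A ≤ 2^m·m·(1 + log₂ m).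

open import Level using (0ℓ)
open import Data.Nat as ℕ using (ℕ; zero; suc; _<_; _≤_; _∸_; _<ᵇ_; z≤n; s≤s; NonZero)
import Data.Nat.Properties as ℕP
import Data.Nat.DivMod as DM
open import Data.Nat.Divisibility using (divides)
open import Data.Nat.Tactic.RingSolver using (solve-∀)
open import Data.Bool using (Bool; true; false; if_then_else_; T)
open import Data.Unit using (⊤)
open import Data.Fin as Fin using (Fin; toℕ; fromℕ<)
import Data.Fin.Properties as FinP
open import Data.List using (List; []; _∷_; _++_; length; tabulate)
import Data.List.Properties as LP
open import Data.Product using (Σ; _×_; _,_; proj₁; proj₂)
open import Data.Empty using (⊥-elim)
open import Relation.Nullary using (¬_; yes; no)
open import Relation.Binary.PropositionalEquality as ≡ using (_≡_)
open import Algebra.Bundles using (CommutativeRing)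
open import Defs

2^≢0 : ∀ s → NonZero (2 ℕ.^ s)
2^≢0 s = ℕP.m^n≢0 2 s

if-<ᵇ-yes : ∀ {A : Set} {a b : ℕ} {x y : A} → a < b → (if a <ᵇ b then x else y) ≡ x
if-<ᵇ-yes {a = a} {b} a<b with a <ᵇ b | ℕP.<⇒<ᵇ a<b
... | true | _ = ≡.refl

if-<ᵇ-no : ∀ {A : Set} {a b : ℕ} {x y : A} → b ≤ a → (if a <ᵇ b then x else y) ≡ y
if-<ᵇ-no {a = a} {b} b≤a with a <ᵇ b in eq
... | false = ≡.refl
... | true = ⊥-elim (ℕP.<⇒≱ (ℕP.<ᵇ⇒< a b (≡.subst T (≡.sym eq) _)) b≤a)

<ᵇ-false⇒≥ : ∀ {a b} → (a <ᵇ b) ≡ false → b ≤ a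
<ᵇ-false⇒≥ {a} {b} eq with b ℕP.≤? a
... | yes b≤a = b≤a
... | no b≰a = ⊥-elim (≡.subst T eq (ℕP.<⇒<ᵇ (ℕP.≰⇒> b≰a)))

<ᵇ-true⇒< : ∀ {a b} → (a <ᵇ b) ≡ true → a < b
<ᵇ-true⇒< {a} {b} eq = ℕP.<ᵇ⇒< a b (≡.subst T (≡.sym eq) _)

2*≡+ : ∀ n → 2 ℕ.* n ≡ n ℕ.+ n
2*≡+ n = ≡.cong (n ℕ.+_) (ℕP.+-identityʳ n)

block-index< : ∀ b D i j → i < D → j < b → i ℕ.* b ℕ.+ j < b ℕ.* D
block-index< b D i j i<D j<b = ℕP.<-≤-trans (ℕP.+-monoʳ-< (i ℕ.* b) j<b)
  (≡.subst (_≤ b ℕ.* D) (ℕP.+-comm b (i ℕ.* b)) (≡.subst (suc i ℕ.* b ≤_) (ℕP.*-comm D b) (ℕP.*-monoˡ-≤ b i<D)))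

block-index-shift : ∀ b D i j → (D ℕ.+ i) ℕ.* b ℕ.+ j ≡ b ℕ.* D ℕ.+ (i ℕ.* b ℕ.+ j)
block-index-shift = solve-∀

module Binary (R : CommutativeRing 0ℓ 0ℓ) where

  private
    odd? : ℕ → Bool
    odd? zero = false
    odd? (suc _) = true

    bit-0-digit : ∀ i → bit R i 0 ≡ odd? (i DM.% 2)
    bit-0-digit i with i DM.% 2
    ... | zero = ≡.refl
    ... | suc _ = ≡.refl

  bit-/2^ : ∀ s i u → bit R i (s ℕ.+ u) ≡ bit R ((i DM./ (2 ℕ.^ s)) {{2^≢0 s}}) u
  bit-/2^ zero i u = ≡.cong (λ z → bit R z u) (≡.sym (DM.n/1≡n i))
  bit-/2^ (suc s) i u = ≡.trans (bit-/2^ s (i DM./ 2) u)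
    (≡.cong (λ z → bit R z u) (DM.m/n/o≡m/[n*o] i 2 (2 ℕ.^ s) {{_}} {{2^≢0 s}} {{2^≢0 (suc s)}}))

  bit-%2^ : ∀ s i t → t < s → bit R i t ≡ bit R ((i DM.% (2 ℕ.^ s)) {{2^≢0 s}}) t
  bit-%2^ (suc s) i zero _ = ≡.trans (bit-0-digit i) (≡.trans (≡.cong odd? (≡.sym
      (DM.m∣n⇒o%n%m≡o%m 2 (2 ℕ.^ suc s) i {{_}} {{2^≢0 (suc s)}} (divides (2 ℕ.^ s) (ℕP.*-comm 2 (2 ℕ.^ s))))))
    (≡.sym (bit-0-digit ((i DM.% (2 ℕ.^ suc s)) {{2^≢0 (suc s)}}))))
  bit-%2^ (suc s) i (suc t) (s≤s t<s) = ≡.trans (bit-%2^ s (i DM./ 2) t t<s)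
      (≡.cong (λ z → bit R z t) (≡.sym %2^-/2))
    where
    %2^-/2 : (i DM.% (2 ℕ.* 2 ℕ.^ s)) {{2^≢0 (suc s)}} DM./ 2 ≡ ((i DM./ 2) DM.% (2 ℕ.^ s)) {{2^≢0 s}}
    %2^-/2 = ≡.trans
      (DM./-congˡ {o = 2} (DM.%-congʳ {o = i} {{2^≢0 (suc s)}} {{ℕP.m*n≢0 (2 ℕ.^ s) 2 {{2^≢0 s}}}} (ℕP.*-comm 2 (2 ℕ.^ s))))
      (DM.m%[n*o]/o≡m/o%n i (2 ℕ.^ s) 2 {{2^≢0 s}} {{_}} {{ℕP.m*n≢0 (2 ℕ.^ s) 2 {{2^≢0 s}}}})

  bit-of-0 : ∀ u → bit R 0 u ≡ false
  bit-of-0 zero = ≡.refl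
  bit-of-0 (suc u) = bit-of-0 u

module CharTwo (R : CommutativeRing 0ℓ 0ℓ) (char2 : Char2 R) where
  open CommutativeRing R renaming (Carrier to K)
  open import Relation.Binary.Reasoning.Setoid setoid
  open import Algebra.Solver.Ring.NaturalCoefficients.Default commutativeSemiring
    using (solve; _:=_; _:+_; _:*_; con)

  Σ< : ℕ → (ℕ → K) → K
  Σ< = sumTo R

  _^_ : K → ℕ → K
  _^_ = _^K_ R
  infixr 8 _^_

  x+x≈0 : ∀ x → x + x ≈ 0#
  x+x≈0 x = begin
    x + x          ≈⟨ solve 1 (λ x → x :+ x := (con 1 :+ con 1) :* x) refl x ⟩
    (1# + 1#) * x  ≈⟨ *-congʳ char2 ⟩
    0# * x         ≈⟨ zeroˡ x ⟩
    0#             ∎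

  -x≈x : ∀ x → - x ≈ x
  -x≈x x = begin
    - x            ≈⟨ sym (+-identityʳ (- x)) ⟩
    - x + 0#       ≈⟨ +-congˡ (sym (x+x≈0 x)) ⟩
    - x + (x + x)  ≈⟨ sym (+-assoc (- x) x x) ⟩
    (- x + x) + x  ≈⟨ +-congʳ (-‿inverseˡ x) ⟩
    0# + x         ≈⟨ +-identityˡ x ⟩
    x              ∎

  x-y≈x+y : ∀ x y → x - y ≈ x + y
  x-y≈x+y x y = +-congˡ (-x≈x y)

  x+[y+y]≈x : ∀ x y → x + (y + y) ≈ x
  x+[y+y]≈x x y = trans (+-congˡ (x+x≈0 y)) (+-identityʳ x)

  Σ<-cong : ∀ n {g h : ℕ → K} → (∀ t → t < n → g t ≈ h t) → Σ< n g ≈ Σ< n h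
  Σ<-cong zero eq = refl
  Σ<-cong (suc n) eq = +-cong (Σ<-cong n (λ t t<n → eq t (ℕP.m<n⇒m<1+n t<n))) (eq n ℕP.≤-refl)

  Σ<-+ : ∀ a b (g : ℕ → K) → Σ< (a ℕ.+ b) g ≈ Σ< a g + Σ< b (λ u → g (a ℕ.+ u))
  Σ<-+ a zero g = ≡.subst (λ z → Σ< z g ≈ Σ< a g + 0#) (≡.sym (ℕP.+-identityʳ a)) (sym (+-identityʳ _))
  Σ<-+ a (suc b) g = ≡.subst (λ z → Σ< z g ≈ Σ< a g + Σ< (suc b) (λ u → g (a ℕ.+ u))) (≡.sym (ℕP.+-suc a b)) (begin
    Σ< (a ℕ.+ b) g + g (a ℕ.+ b)                      ≈⟨ +-congʳ (Σ<-+ a b g) ⟩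
    (Σ< a g + Σ< b (λ u → g (a ℕ.+ u))) + g (a ℕ.+ b)  ≈⟨ +-assoc _ _ _ ⟩
    Σ< a g + (Σ< b (λ u → g (a ℕ.+ u)) + g (a ℕ.+ b))  ∎)

  Σ<-distrib-+ : ∀ n (g h : ℕ → K) → Σ< n (λ t → g t + h t) ≈ Σ< n g + Σ< n h
  Σ<-distrib-+ zero g h = sym (+-identityˡ 0#)
  Σ<-distrib-+ (suc n) g h = begin
    Σ< n (λ t → g t + h t) + (g n + h n)  ≈⟨ +-congʳ (Σ<-distrib-+ n g h) ⟩
    (Σ< n g + Σ< n h) + (g n + h n)       ≈⟨ solve 4 (λ a b c d → (a :+ b) :+ (c :+ d) := (a :+ c) :+ (b :+ d)) refl _ _ _ _ ⟩
    (Σ< n g + g n) + (Σ< n h + h n)       ∎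

  *-distribˡ-Σ< : ∀ n y (g : ℕ → K) → y * Σ< n g ≈ Σ< n (λ t → y * g t)
  *-distribˡ-Σ< zero y g = zeroʳ y
  *-distribˡ-Σ< (suc n) y g = trans (distribˡ y _ _) (+-congʳ (*-distribˡ-Σ< n y g))

  Σ<-zero : ∀ n (g : ℕ → K) → (∀ t → t < n → g t ≈ 0#) → Σ< n g ≈ 0#
  Σ<-zero zero g eq = refl
  Σ<-zero (suc n) g eq = trans (+-cong (Σ<-zero n g (λ t t<n → eq t (ℕP.m<n⇒m<1+n t<n))) (eq n ℕP.≤-refl)) (+-identityʳ 0#)

  Σ<-comm : ∀ n k (g : ℕ → ℕ → K) → Σ< n (λ i → Σ< k (g i)) ≈ Σ< k (λ j → Σ< n (λ i → g i j))
  Σ<-comm zero k g = sym (Σ<-zero k (λ _ → 0#) (λ _ _ → refl))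
  Σ<-comm (suc n) k g = begin
    Σ< n (λ i → Σ< k (g i)) + Σ< k (g n)            ≈⟨ +-congʳ (Σ<-comm n k g) ⟩
    Σ< k (λ j → Σ< n (λ i → g i j)) + Σ< k (g n)   ≈⟨ sym (Σ<-distrib-+ k _ _) ⟩
    Σ< k (λ j → Σ< n (λ i → g i j) + g n j)        ∎

  ^-cong : ∀ n {x y} → x ≈ y → x ^ n ≈ y ^ n
  ^-cong zero eq = refl
  ^-cong (suc n) eq = *-cong (^-cong n eq) eq

  ^-congʳ : ∀ x {a b} → a ≡ b → x ^ a ≈ x ^ b
  ^-congʳ x eq = reflexive (≡.cong (x ^_) eq)

  ^-distribˡ-+-* : ∀ x a b → x ^ (a ℕ.+ b) ≈ x ^ a * x ^ b
  ^-distribˡ-+-* x zero b = sym (*-identityˡ _)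
  ^-distribˡ-+-* x (suc a) b = begin
    x ^ (a ℕ.+ b) * x    ≈⟨ *-congʳ (^-distribˡ-+-* x a b) ⟩
    (x ^ a * x ^ b) * x  ≈⟨ solve 3 (λ p q x → (p :* q) :* x := (p :* x) :* q) refl _ _ _ ⟩
    (x ^ a * x) * x ^ b  ∎

  ^-*-assoc : ∀ x a b → x ^ (a ℕ.* b) ≈ (x ^ a) ^ b
  ^-*-assoc x a zero = ^-congʳ x (ℕP.*-zeroʳ a)
  ^-*-assoc x a (suc b) = begin
    x ^ (a ℕ.* suc b)        ≈⟨ ^-congʳ x (ℕP.*-suc a b) ⟩
    x ^ (a ℕ.+ a ℕ.* b)      ≈⟨ ^-distribˡ-+-* x a (a ℕ.* b) ⟩
    x ^ a * x ^ (a ℕ.* b)    ≈⟨ *-congˡ (^-*-assoc x a b) ⟩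
    x ^ a * (x ^ a) ^ b      ≈⟨ *-comm _ _ ⟩
    (x ^ a) ^ b * x ^ a      ∎

  frobenius : ∀ d x y → (x + y) ^ (2 ℕ.^ d) ≈ x ^ (2 ℕ.^ d) + y ^ (2 ℕ.^ d)
  frobenius zero x y = solve 2 (λ x y → con 1 :* (x :+ y) := con 1 :* x :+ con 1 :* y) refl x y
  frobenius (suc d) x y = begin
    (x + y) ^ (2 ℕ.* 2 ℕ.^ d)                  ≈⟨ ^-*-assoc (x + y) 2 (2 ℕ.^ d) ⟩
    ((x + y) ^ 2) ^ (2 ℕ.^ d)                  ≈⟨ ^-cong (2 ℕ.^ d) square-+ ⟩
    (x ^ 2 + y ^ 2) ^ (2 ℕ.^ d)                ≈⟨ frobenius d _ _ ⟩
    (x ^ 2) ^ (2 ℕ.^ d) + (y ^ 2) ^ (2 ℕ.^ d)  ≈⟨ sym (+-cong (^-*-assoc x 2 (2 ℕ.^ d)) (^-*-assoc y 2 (2 ℕ.^ d))) ⟩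
    x ^ (2 ℕ.* 2 ℕ.^ d) + y ^ (2 ℕ.* 2 ℕ.^ d)  ∎
    where
    square-+ : (x + y) ^ 2 ≈ x ^ 2 + y ^ 2
    square-+ = trans
      (solve 2 (λ x y → (con 1 :* (x :+ y)) :* (x :+ y) := ((con 1 :* x) :* x :+ (con 1 :* y) :* y) :+ (x :* y :+ x :* y)) refl x y)
      (x+[y+y]≈x _ _)

  σ : ℕ → K → K
  σ r x = x ^ (2 ℕ.^ (2 ℕ.^ r)) + x

  σ-cong : ∀ r {x y} → x ≈ y → σ r x ≈ σ r y
  σ-cong r eq = +-cong (^-cong (2 ℕ.^ (2 ℕ.^ r)) eq) eq

  σ-+ : ∀ r x y → σ r (x + y) ≈ σ r x + σ r y
  σ-+ r x y = begin
    (x + y) ^ P + (x + y)      ≈⟨ +-congʳ (frobenius (2 ℕ.^ r) x y) ⟩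
    (x ^ P + y ^ P) + (x + y)  ≈⟨ solve 4 (λ a b x y → (a :+ b) :+ (x :+ y) := (a :+ x) :+ (b :+ y)) refl _ _ _ _ ⟩
    σ r x + σ r y              ∎
    where P = 2 ℕ.^ (2 ℕ.^ r)

  σ-0 : ∀ r → σ r 0# ≈ 0#
  σ-0 r = begin
    σ r 0#            ≈⟨ σ-cong r (sym (+-identityʳ 0#)) ⟩
    σ r (0# + 0#)     ≈⟨ σ-+ r 0# 0# ⟩
    σ r 0# + σ r 0#   ≈⟨ x+x≈0 _ ⟩
    0#                ∎

  σ-suc : ∀ r x → σ (suc r) x ≈ σ r (σ r x)
  σ-suc r x = begin
    x ^ (2 ℕ.^ (2 ℕ.^ suc r)) + x              ≈⟨ +-congʳ (^-congʳ x P²) ⟩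
    x ^ (P ℕ.* P) + x                          ≈⟨ +-congʳ (^-*-assoc x P P) ⟩
    (x ^ P) ^ P + x                            ≈⟨ sym (x+[y+y]≈x _ _) ⟩
    ((x ^ P) ^ P + x) + (x ^ P + x ^ P)        ≈⟨ solve 3 (λ a b c → (a :+ c) :+ (b :+ b) := (a :+ b) :+ (b :+ c)) refl _ _ _ ⟩
    ((x ^ P) ^ P + x ^ P) + (x ^ P + x)        ≈⟨ +-congʳ (sym (frobenius (2 ℕ.^ r) (x ^ P) x)) ⟩
    (x ^ P + x) ^ P + (x ^ P + x)              ∎
    where
    P = 2 ℕ.^ (2 ℕ.^ r)
    P² : 2 ℕ.^ (2 ℕ.^ suc r) ≡ P ℕ.* P
    P² = ≡.trans (≡.cong (2 ℕ.^_) (2*≡+ (2 ℕ.^ r))) (ℕP.^-distribˡ-+-* 2 (2 ℕ.^ r) (2 ℕ.^ r))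

  scal-cong : ∀ b {x y} → x ≈ y → scal R b x ≈ scal R b y
  scal-cong true eq = eq
  scal-cong false eq = refl

  σ-scal : ∀ r b y → σ r (scal R b y) ≈ scal R b (σ r y)
  σ-scal r true y = refl
  σ-scal r false y = σ-0 r

  σ-Σ< : ∀ r n g → σ r (Σ< n g) ≈ Σ< n (λ t → σ r (g t))
  σ-Σ< r zero g = σ-0 r
  σ-Σ< r (suc n) g = trans (σ-+ r _ _) (+-congʳ (σ-Σ< r n g))

  poly : ℕ → (ℕ → K) → K → K
  poly n c x = Σ< n (λ j → c j * x ^ j)

  poly-cong : ∀ n {c d : ℕ → K} → (∀ j → j < n → c j ≈ d j) → ∀ {x y} → x ≈ y → poly n c x ≈ poly n d y
  poly-cong n eq x≈y = Σ<-cong n (λ j j<n → *-cong (eq j j<n) (^-cong j x≈y))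

  poly-congˡ : ∀ {n n'} → n ≡ n' → ∀ c x → poly n c x ≈ poly n' c x
  poly-congˡ ≡.refl c x = refl

  poly≈evalPoly : ∀ N (f : Fin N → K) c → (∀ j (j<N : j < N) → c j ≈ f (fromℕ< j<N)) → ∀ x → poly N c x ≈ evalPoly R N f x
  poly≈evalPoly N f c c≈f x = Σ<-cong N term
    where
    -- Naming the summand of evalPoly exposes the test j <? N of its coefficient function to the with below.
    summand : Σ (ℕ → K) (λ g → evalPoly R N f x ≡ Σ< N g)
    summand = _ , ≡.refl
    term : ∀ j → j < N → c j * x ^ j ≈ proj₁ summand j
    term j j<N with j ℕ.<? N
    ... | yes j<N' = *-congʳ (c≈f j j<N')
    ... | no j≮N = ⊥-elim (j≮N j<N)

  poly-+ : ∀ a b c x → poly (a ℕ.+ b) c x ≈ poly a c x + x ^ a * poly b (λ u → c (a ℕ.+ u)) x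
  poly-+ a b c x = begin
    poly (a ℕ.+ b) c x                                      ≈⟨ Σ<-+ a b _ ⟩
    poly a c x + Σ< b (λ u → c (a ℕ.+ u) * x ^ (a ℕ.+ u))   ≈⟨ +-congˡ (Σ<-cong b (λ u _ → shift u)) ⟩
    poly a c x + Σ< b (λ u → x ^ a * (c (a ℕ.+ u) * x ^ u)) ≈⟨ +-congˡ (sym (*-distribˡ-Σ< b _ _)) ⟩
    poly a c x + x ^ a * poly b (λ u → c (a ℕ.+ u)) x       ∎
    where
    shift : ∀ u → c (a ℕ.+ u) * x ^ (a ℕ.+ u) ≈ x ^ a * (c (a ℕ.+ u) * x ^ u)
    shift u = trans (*-congˡ (^-distribˡ-+-* x a u)) (solve 3 (λ p y z → p :* (y :* z) := y :* (p :* z)) refl _ _ _)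

  poly-distrib-+ : ∀ n c d x → poly n (λ j → c j + d j) x ≈ poly n c x + poly n d x
  poly-distrib-+ n c d x = trans (Σ<-cong n (λ j _ → distribʳ _ _ _)) (Σ<-distrib-+ n _ _)

  poly-+-low : ∀ D F c d h x → (∀ t → t < D → h t ≈ c t + d t) → (∀ t → D ≤ t → t < D ℕ.+ F → h t ≈ c t) →
               poly (D ℕ.+ F) h x ≈ poly (D ℕ.+ F) c x + poly D d x
  poly-+-low D F c d h x low high = begin
    poly (D ℕ.+ F) h x                                             ≈⟨ poly-+ D F h x ⟩
    poly D h x + x ^ D * poly F (λ u → h (D ℕ.+ u)) x              ≈⟨ +-cong
       (trans (poly-cong D low refl) (poly-distrib-+ D c d x))
       (*-congˡ (poly-cong F (λ u u<F → high (D ℕ.+ u) (ℕP.m≤m+n D u) (ℕP.+-monoʳ-< D u<F)) refl)) ⟩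
    (poly D c x + poly D d x) + x ^ D * poly F (λ u → c (D ℕ.+ u)) x ≈⟨ solve 3 (λ a b z → (a :+ b) :+ z := (a :+ z) :+ b) refl _ _ _ ⟩
    (poly D c x + x ^ D * poly F (λ u → c (D ℕ.+ u)) x) + poly D d x ≈⟨ +-congʳ (sym (poly-+ D F c x)) ⟩
    poly (D ℕ.+ F) c x + poly D d x                                ∎

  -- Division with remainder by X^M + X^D, where M = D + E and E = D + F: quotient g1, remainder g0.
  poly-divMod : ∀ D F M → M ≡ D ℕ.+ (D ℕ.+ F) → ∀ (c g0 g1 : ℕ → K) → let E = D ℕ.+ F in
    (∀ t → t < D → g1 t ≈ c (M ℕ.+ t) + c (M ℕ.+ E ℕ.+ t)) →
    (∀ t → D ≤ t → t < M → g1 t ≈ c (M ℕ.+ t)) →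
    (∀ j → j < D → g0 j ≈ c j) →
    (∀ u → u < E → g0 (D ℕ.+ u) ≈ c (D ℕ.+ u) + g1 u) →
    ∀ x → poly (M ℕ.+ M) c x ≈ poly M g0 x + (x ^ D * x ^ E + x ^ D) * poly M g1 x
  poly-divMod D F .(D ℕ.+ (D ℕ.+ F)) ≡.refl c g0 g1 g1-low g1-high g0-low g0-high x = begin
    poly (M ℕ.+ M) c x                         ≈⟨ poly-+ M M c x ⟩
    C0 + x ^ M * poly M cM x                   ≈⟨ +-congˡ (*-cong (^-distribˡ-+-* x D E) upper) ⟩
    C0 + (u * w) * (A + w * B)                 ≈⟨ sym (x+[y+y]≈x _ _) ⟩
    C0 + u * w * (A + w * B) + (Z + Z)         ≈⟨ sym (regroup C0 A B u w) ⟩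
    C0 + u * (A + B) + (u * w + u) * (A + w * B + B) ≈⟨ +-cong (sym remainder) (*-congˡ (sym quotient)) ⟩
    poly M g0 x + (u * w + u) * poly M g1 x    ∎
    where
    E = D ℕ.+ F
    M = D ℕ.+ E
    cM = λ t → c (M ℕ.+ t)
    C0 = poly M c x
    A = poly E cM x
    B = poly D (λ t → c (M ℕ.+ E ℕ.+ t)) x
    u = x ^ D
    w = x ^ E
    Z = u * A + u * B + u * w * B
    regroup : ∀ C A B u w → C + u * (A + B) + (u * w + u) * (A + w * B + B) ≈
                            C + u * w * (A + w * B) + ((u * A + u * B + u * w * B) + (u * A + u * B + u * w * B))
    regroup = solve 5 (λ C A B u w → C :+ u :* (A :+ B) :+ (u :* w :+ u) :* (A :+ w :* B :+ B) :=
                       C :+ u :* w :* (A :+ w :* B) :+ ((u :* A :+ u :* B :+ u :* w :* B) :+ (u :* A :+ u :* B :+ u :* w :* B))) refl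
    upper : poly M cM x ≈ A + w * B
    upper = begin
      poly M cM x                                  ≈⟨ poly-congˡ (ℕP.+-comm D E) cM x ⟩
      poly (E ℕ.+ D) cM x                          ≈⟨ poly-+ E D cM x ⟩
      A + w * poly D (λ t → cM (E ℕ.+ t)) x        ≈⟨ +-congˡ (*-congˡ (poly-cong D (λ t _ → reflexive (≡.cong c (≡.sym (ℕP.+-assoc M E t)))) refl)) ⟩
      A + w * B                                    ∎
    quotient : poly M g1 x ≈ A + w * B + B
    quotient = trans (poly-+-low D E cM _ g1 x g1-low g1-high) (+-congʳ upper)
    remainder : poly M g0 x ≈ C0 + u * (A + B)
    remainder = begin
      poly M g0 x                                              ≈⟨ poly-+ D E g0 x ⟩
      poly D g0 x + u * poly E (λ v → g0 (D ℕ.+ v)) x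
        ≈⟨ +-cong (poly-cong D g0-low refl) (*-congˡ (trans (poly-cong E g0-high refl) (poly-distrib-+ E _ g1 x))) ⟩
      poly D c x + u * (poly E (λ v → c (D ℕ.+ v)) x + poly E g1 x)
        ≈⟨ +-congˡ (*-congˡ (+-congˡ (poly-+-low D F cM _ g1 x g1-low (λ t D≤t t<E → g1-high t D≤t (ℕP.<-≤-trans t<E (ℕP.m≤n+m E D)))))) ⟩
      poly D c x + u * (poly E (λ v → c (D ℕ.+ v)) x + (A + B)) ≈⟨ solve 4 (λ a u y z → a :+ u :* (y :+ z) := (a :+ u :* y) :+ u :* z) refl _ _ _ _ ⟩
      (poly D c x + u * poly E (λ v → c (D ℕ.+ v)) x) + u * (A + B) ≈⟨ +-congʳ (sym (poly-+ D E c x)) ⟩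
      C0 + u * (A + B)                                         ∎

  poly-poly : ∀ b k (e : ℕ → ℕ → K) x y →
    poly b (λ j → poly k (λ i → e i j) y) x ≈ poly k (λ i → poly b (e i) x) y
  poly-poly b k e x y = begin
    Σ< b (λ j → Σ< k (λ i → e i j * y ^ i) * x ^ j)     ≈⟨ Σ<-cong b (λ j _ → trans (*-comm _ _) (*-distribˡ-Σ< k _ _)) ⟩
    Σ< b (λ j → Σ< k (λ i → x ^ j * (e i j * y ^ i)))   ≈⟨ sym (Σ<-comm k b _) ⟩
    Σ< k (λ i → Σ< b (λ j → x ^ j * (e i j * y ^ i)))   ≈⟨ Σ<-cong k (λ i _ → trans (Σ<-cong b (λ j _ →
         solve 3 (λ p q r → p :* (q :* r) := r :* (q :* p)) refl _ _ _)) (trans (sym (*-distribˡ-Σ< b _ _)) (*-comm _ _))) ⟩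
    poly k (λ i → poly b (e i) x) y                     ∎

  poly-halves : ∀ D (G G₀ G₁ : ℕ → K) y → (∀ i → i < D → G i ≈ G₀ i) → (∀ i → i < D → G (D ℕ.+ i) ≈ G₁ i) →
    poly (D ℕ.+ D) G y ≈ poly D G₀ y + y ^ D * poly D G₁ y
  poly-halves D G G₀ G₁ y low high = trans (poly-+ D D G y) (+-cong (poly-cong D low refl) (*-congˡ (poly-cong D high refl)))

  comb-cong : ∀ n c {β β' : ℕ → K} → (∀ t → t < n → β t ≈ β' t) → comb R n c β ≈ comb R n c β'
  comb-cong n c eq = Σ<-cong n (λ t t<n → scal-cong (c t) (eq t t<n))

  comb-zero : ∀ n c (β : ℕ → K) → (∀ t → t < n → β t ≈ 0#) → comb R n c β ≈ 0#
  comb-zero n c β eq = Σ<-zero n _ (λ t t<n → trans (scal-cong (c t) (eq t t<n)) (scal-0 (c t)))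
    where
    scal-0 : ∀ b → scal R b 0# ≈ 0#
    scal-0 true = refl
    scal-0 false = refl

  σ-comb : ∀ r n c (β : ℕ → K) → σ r (comb R n c β) ≈ comb R n c (λ t → σ r (β t))
  σ-comb r n c β = trans (σ-Σ< r n _) (Σ<-cong n (λ t _ → σ-scal r (c t) (β t)))

  open Binary R

  varpi-+ : ∀ s k i (β : ℕ → K) →
    varpi R (s ℕ.+ k) β i ≈ varpi R s β ((i DM.% (2 ℕ.^ s)) {{2^≢0 s}}) + varpi R k (λ u → β (s ℕ.+ u)) ((i DM./ (2 ℕ.^ s)) {{2^≢0 s}})
  varpi-+ s k i β = trans (Σ<-+ s k _) (+-cong
    (Σ<-cong s (λ t t<s → reflexive (≡.cong (λ b → scal R b (β t)) (bit-%2^ s i t t<s))))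
    (Σ<-cong k (λ u _ → reflexive (≡.cong (λ b → scal R b (β (s ℕ.+ u))) (bit-/2^ s i u)))))

  varpi-truncate : ∀ m n i (β : ℕ → K) → i < 2 ℕ.^ m → m ≤ n → varpi R n β i ≈ varpi R m β i
  varpi-truncate m n i β i<2^m m≤n = begin
    Σ< n g                                         ≈⟨ reflexive (≡.cong (λ z → Σ< z g) (≡.sym (ℕP.m+[n∸m]≡n m≤n))) ⟩
    Σ< (m ℕ.+ (n ∸ m)) g                           ≈⟨ Σ<-+ m (n ∸ m) g ⟩
    Σ< m g + Σ< (n ∸ m) (λ u → g (m ℕ.+ u))        ≈⟨ +-congˡ (Σ<-zero (n ∸ m) _ high-bits-0) ⟩
    Σ< m g + 0#                                    ≈⟨ +-identityʳ _ ⟩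
    varpi R m β i                                  ∎
    where
    g = λ t → scal R (bit R i t) (β t)
    high-bits-0 : ∀ u → u < n ∸ m → g (m ℕ.+ u) ≈ 0#
    high-bits-0 u _ = reflexive (≡.cong (λ b → scal R b (β (m ℕ.+ u)))
      (≡.trans (bit-/2^ m i u) (≡.trans (≡.cong (λ z → bit R z u) (DM.m<n⇒m/n≡0 {{2^≢0 m}} i<2^m)) (bit-of-0 u))))

  module CantorBasis (β : ℕ → K) (n : ℕ) (β0≈1 : β 0 ≈ 1#)
                     (β-step : ∀ t → suc t < n → (β (suc t) * β (suc t)) - β (suc t) ≈ β t) where

    σ-β-shift : ∀ r u → u ℕ.+ 2 ℕ.^ r < n → σ r (β (u ℕ.+ 2 ℕ.^ r)) ≈ β u
    σ-β-shift zero u lt = begin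
      σ 0 (β (u ℕ.+ 1))                       ≈⟨ σ-cong 0 (reflexive (≡.cong β (ℕP.+-comm u 1))) ⟩
      (1# * β (suc u)) * β (suc u) + β (suc u) ≈⟨ +-congʳ (*-congʳ (*-identityˡ _)) ⟩
      β (suc u) * β (suc u) + β (suc u)        ≈⟨ sym (x-y≈x+y _ _) ⟩
      β (suc u) * β (suc u) - β (suc u)        ≈⟨ β-step u (≡.subst (_< n) (ℕP.+-comm u 1) lt) ⟩
      β u                                      ∎
    σ-β-shift (suc r) u lt = begin
      σ (suc r) (β (u ℕ.+ 2 ℕ.^ suc r))        ≈⟨ σ-cong (suc r) (reflexive (≡.cong β split)) ⟩
      σ (suc r) (β (u' ℕ.+ 2 ℕ.^ r))           ≈⟨ σ-suc r _ ⟩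
      σ r (σ r (β (u' ℕ.+ 2 ℕ.^ r)))           ≈⟨ σ-cong r (σ-β-shift r u' (≡.subst (_< n) split lt)) ⟩
      σ r (β u')                               ≈⟨ σ-β-shift r u (ℕP.≤-<-trans (ℕP.m≤m+n _ (2 ℕ.^ r)) (≡.subst (_< n) split lt)) ⟩
      β u                                      ∎
      where
      u' = u ℕ.+ 2 ℕ.^ r
      split : u ℕ.+ 2 ℕ.^ suc r ≡ u' ℕ.+ 2 ℕ.^ r
      split = ≡.trans (≡.cong (u ℕ.+_) (2*≡+ (2 ℕ.^ r))) (≡.sym (ℕP.+-assoc u _ _))

    σ-β-vanish : ∀ r t → t < 2 ℕ.^ r → t < n → σ r (β t) ≈ 0#
    σ-β-vanish zero zero _ _ = begin
      σ 0 (β 0)  ≈⟨ σ-cong 0 β0≈1 ⟩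
      σ 0 1#     ≈⟨ +-congʳ (trans (*-identityʳ _) (*-identityʳ _)) ⟩
      1# + 1#    ≈⟨ char2 ⟩
      0#         ∎
    σ-β-vanish zero (suc t) (s≤s ()) _
    σ-β-vanish (suc r) t t<2^[1+r] t<n with t ℕP.<? 2 ℕ.^ r
    ... | yes t<2^r = begin
      σ (suc r) (β t)  ≈⟨ σ-suc r _ ⟩
      σ r (σ r (β t))  ≈⟨ σ-cong r (σ-β-vanish r t t<2^r t<n) ⟩
      σ r 0#           ≈⟨ σ-0 r ⟩
      0#               ∎
    ... | no t≮2^r = begin
      σ (suc r) (β t)  ≈⟨ σ-suc r _ ⟩
      σ r (σ r (β t))  ≈⟨ σ-cong r (trans (σ-cong r (reflexive (≡.cong β (≡.sym t≡u+2^r))))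
                                          (σ-β-shift r u (≡.subst (_< n) (≡.sym t≡u+2^r) t<n))) ⟩
      σ r (β u)        ≈⟨ σ-β-vanish r u u<2^r (ℕP.≤-<-trans (ℕP.m∸n≤m t (2 ℕ.^ r)) t<n) ⟩
      0#               ∎
      where
      u = t ∸ 2 ℕ.^ r
      t≡u+2^r : u ℕ.+ 2 ℕ.^ r ≡ t
      t≡u+2^r = ℕP.m∸n+n≡m (ℕP.≮⇒≥ t≮2^r)
      u<2^r : u < 2 ℕ.^ r
      u<2^r = ℕP.+-cancelʳ-< _ u (2 ℕ.^ r) (≡.subst (_< 2 ℕ.^ r ℕ.+ 2 ℕ.^ r) (≡.sym t≡u+2^r)
                (≡.subst (t <_) (2*≡+ (2 ℕ.^ r)) t<2^[1+r]))

    -- The second summand is ϖ_{hi·2^(2^r)}: σ r collapses each coset of W_{2^r} to a single point.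
    σ-coset : ∀ r k → 2 ℕ.^ r ℕ.+ k ≤ n → ∀ a hi lo →
      σ r ((a + varpi R k (λ u → β (2 ℕ.^ r ℕ.+ u)) hi) + varpi R (2 ℕ.^ r) β lo) ≈ σ r a + varpi R k β hi
    σ-coset r k s+k≤n a hi lo = begin
      σ r ((a + high) + low)              ≈⟨ σ-+ r _ _ ⟩
      σ r (a + high) + σ r low            ≈⟨ +-cong (σ-+ r _ _) low↦0 ⟩
      (σ r a + σ r high) + 0#             ≈⟨ +-identityʳ _ ⟩
      σ r a + σ r high                    ≈⟨ +-congˡ high↦ ⟩
      σ r a + varpi R k β hi              ∎
      where
      s = 2 ℕ.^ r
      high = varpi R k (λ u → β (s ℕ.+ u)) hi
      low = varpi R s β lo
      low↦0 : σ r low ≈ 0#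
      low↦0 = trans (σ-comb r s _ β) (comb-zero s _ _ (λ t t<s →
        σ-β-vanish r t t<s (ℕP.<-≤-trans t<s (ℕP.≤-trans (ℕP.m≤m+n s k) s+k≤n))))
      high↦ : σ r high ≈ varpi R k β hi
      high↦ = trans (σ-comb r k _ _) (comb-cong k _ (λ u u<k →
        trans (σ-cong r (reflexive (≡.cong β (ℕP.+-comm s u))))
              (σ-β-shift r u (ℕP.<-≤-trans (≡.subst (_< s ℕ.+ k) (ℕP.+-comm s u) (ℕP.+-monoʳ-< s u<k)) s+k≤n))))

module Programs (R : CommutativeRing 0ℓ 0ℓ) (N : ℕ) where
  open CommutativeRing R using (_+_) renaming (Carrier to K)

  Program : Set
  Program = List (Instr R N)

  -- A generated program paired with the register of each of its results.
  OutProgram : Set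
  OutProgram = Program × (ℕ → ℕ)

  _⊑_ : List K → List K → Set
  xs ⊑ ys = Σ (List K) (λ zs → ys ≡ xs ++ zs)

  ⊑-refl : ∀ xs → xs ⊑ xs
  ⊑-refl xs = [] , ≡.sym (LP.++-identityʳ xs)

  ⊑-trans : ∀ {xs ys zs} → xs ⊑ ys → ys ⊑ zs → xs ⊑ zs
  ⊑-trans {xs} (as , ≡.refl) (bs , ≡.refl) = as ++ bs , LP.++-assoc xs as bs

  ⊑-length : ∀ {xs ys} → xs ⊑ ys → length xs ≤ length ys
  ⊑-length {xs} (zs , ≡.refl) = LP.length-++-≤ˡ xs

  reg-++ : ∀ xs ys k → k < length xs → reg R (xs ++ ys) k ≡ reg R xs k
  reg-++ (x ∷ xs) ys zero _ = ≡.refl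
  reg-++ (x ∷ xs) ys (suc k) (s≤s k<) = reg-++ xs ys k k<

  reg-⊑ : ∀ {xs ys} → xs ⊑ ys → ∀ k → k < length xs → reg R ys k ≡ reg R xs k
  reg-⊑ {xs} (zs , ≡.refl) = reg-++ xs zs

  reg-length : ∀ xs y ys → reg R (xs ++ y ∷ ys) (length xs) ≡ y
  reg-length [] y ys = ≡.refl
  reg-length (x ∷ xs) y ys = reg-length xs y ys

  reg-tabulate : ∀ {k} (h : Fin k → K) j (j<k : j < k) → reg R (tabulate h) j ≡ h (fromℕ< j<k)
  reg-tabulate {suc k} h zero _ = ≡.refl
  reg-tabulate {suc k} h (suc j) (s≤s j<k) = reg-tabulate (λ i → h (Fin.suc i)) j j<k

  additions-++ : ∀ (P Q : Program) → additions R (P ++ Q) ≡ additions R P ℕ.+ additions R Q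
  additions-++ [] Q = ≡.refl
  additions-++ (inp _ ∷ P) Q = additions-++ P Q
  additions-++ (const _ ∷ P) Q = additions-++ P Q
  additions-++ (add _ _ ∷ P) Q = ≡.cong suc (additions-++ P Q)
  additions-++ (sub _ _ ∷ P) Q = ≡.cong suc (additions-++ P Q)
  additions-++ (mul _ _ ∷ P) Q = additions-++ P Q

  Operands< : Instr R N → ℕ → Set
  Operands< (add i j) n = i < n × j < n
  Operands< (sub i j) n = i < n × j < n
  Operands< (mul i j) n = i < n × j < n
  Operands< _ n = ⊤

  loadAll : ∀ {k} → (Fin k → Fin N) → Program
  loadAll g = tabulate (λ j → inp (g j))

  loadAll-additions : ∀ {k} (g : Fin k → Fin N) → additions R (loadAll g) ≡ 0
  loadAll-additions {zero} g = ≡.refl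
  loadAll-additions {suc k} g = loadAll-additions (λ j → g (Fin.suc j))

  addAll : ℕ → (ℕ → ℕ) → (ℕ → ℕ) → Program
  addAll zero I J = []
  addAll (suc c) I J = add (I 0) (J 0) ∷ addAll c (λ t → I (suc t)) (λ t → J (suc t))

  addAll-length : ∀ c I J → length (addAll c I J) ≡ c
  addAll-length zero I J = ≡.refl
  addAll-length (suc c) I J = ≡.cong suc (addAll-length c _ _)

  addAll-additions : ∀ c I J → additions R (addAll c I J) ≡ c
  addAll-additions zero I J = ≡.refl
  addAll-additions (suc c) I J = ≡.cong suc (addAll-additions c _ _)

  sequenceGen : ℕ → (ℕ → ℕ → OutProgram) → ℕ → Program × (ℕ → ℕ → ℕ)
  sequenceGen zero body n = [] , (λ _ _ → 0)
  sequenceGen (suc c) body n =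
    proj₁ (body 0 n) ++ proj₁ rest ,
    λ { zero → proj₂ (body 0 n) ; (suc j) → proj₂ rest j }
    where rest = sequenceGen c (λ j → body (suc j)) (n ℕ.+ length (proj₁ (body 0 n)))

  sequenceGen-additions : ∀ c body n B → (∀ j → j < c → ∀ n' → 2 ℕ.* additions R (proj₁ (body j n')) ≤ B) →
    2 ℕ.* additions R (proj₁ (sequenceGen c body n)) ≤ c ℕ.* B
  sequenceGen-additions zero body n B h = z≤n
  sequenceGen-additions (suc c) body n B h =
    ≡.subst (_≤ B ℕ.+ c ℕ.* B) (≡.sym (≡.trans (≡.cong (2 ℕ.*_) (additions-++ (proj₁ (body 0 n)) _))
        (ℕP.*-distribˡ-+ 2 (additions R (proj₁ (body 0 n))) _)))
      (ℕP.+-mono-≤ (h 0 (s≤s z≤n) n) (sequenceGen-additions c _ _ B (λ j j<c n' → h (suc j) (s≤s j<c) n')))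

  module Semantics (f : Fin N → K) where

    exec : List K → Program → List K
    exec = runFrom R f

    exec-++ : ∀ rs P Q → exec rs (P ++ Q) ≡ exec (exec rs P) Q
    exec-++ rs [] Q = ≡.refl
    exec-++ rs (c ∷ P) Q = exec-++ _ P Q

    exec-⊒ : ∀ rs P → rs ⊑ exec rs P
    exec-⊒ rs [] = ⊑-refl rs
    exec-⊒ rs (c ∷ P) = ⊑-trans (_ ∷ [] , ≡.refl) (exec-⊒ _ P)

    exec-length : ∀ rs P → length (exec rs P) ≡ length rs ℕ.+ length P
    exec-length rs [] = ≡.sym (ℕP.+-identityʳ _)
    exec-length rs (c ∷ P) = ≡.trans (exec-length _ P) (≡.trans (≡.cong (ℕ._+ length P) (LP.length-++ rs))
      (ℕP.+-assoc (length rs) 1 (length P)))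

    exec-loadAll : ∀ {k} (g : Fin k → Fin N) rs → exec rs (loadAll g) ≡ rs ++ tabulate (λ j → f (g j))
    exec-loadAll {zero} g rs = ≡.sym (LP.++-identityʳ rs)
    exec-loadAll {suc k} g rs = ≡.trans (exec-loadAll (λ j → g (Fin.suc j)) (rs ++ f (g Fin.zero) ∷ []))
                                        (LP.++-assoc rs (f (g Fin.zero) ∷ []) _)

    step-⊑ : ∀ {rs fs} → rs ⊑ fs → ∀ c → Operands< c (length rs) → step R f rs c ≡ step R f fs c
    step-⊑ ext (inp _) _ = ≡.refl
    step-⊑ ext (const _) _ = ≡.refl
    step-⊑ ext (add i j) (i< , j<) = ≡.sym (≡.cong₂ (CommutativeRing._+_ R) (reg-⊑ ext i i<) (reg-⊑ ext j j<))
    step-⊑ ext (sub i j) (i< , j<) = ≡.sym (≡.cong₂ (CommutativeRing._-_ R) (reg-⊑ ext i i<) (reg-⊑ ext j j<))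
    step-⊑ ext (mul i j) (i< , j<) = ≡.sym (≡.cong₂ (CommutativeRing._*_ R) (reg-⊑ ext i i<) (reg-⊑ ext j j<))

    -- Post is demanded of every extension of the final register file, so it survives instructions appended later.
    Correct : Program → ℕ → (List K → Set) → Set
    Correct P n Post = ∀ rs → length rs ≡ n → ∀ fs → exec rs P ⊑ fs → Post fs

    correct-exec : ∀ {P n Post} → Correct P n Post → ∀ rs → length rs ≡ n → Post (exec rs P)
    correct-exec {P} c rs e = c rs e (exec rs P) (⊑-refl _)

    correct-++ : ∀ {P Q n Post₁ Post₂} → Correct P n Post₁ → Correct Q (n ℕ.+ length P) Post₂ →
                 Correct (P ++ Q) n (λ fs → Post₁ fs × Post₂ fs)
    correct-++ {P} {Q} {n} c₁ c₂ rs e fs ext rewrite exec-++ rs P Q =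
      c₁ rs e fs (⊑-trans (exec-⊒ (exec rs P) Q) ext) ,
      c₂ (exec rs P) (≡.trans (exec-length rs P) (≡.cong (ℕ._+ length P) e)) fs ext

    correct-weaken : ∀ {P n} {Post₁ Post₂ : List K → Set} → (∀ fs → Post₁ fs → Post₂ fs) → Correct P n Post₁ → Correct P n Post₂
    correct-weaken h c rs e fs ext = h fs (c rs e fs ext)

    correct-length : ∀ P n → Correct P n (λ fs → n ℕ.+ length P ≤ length fs)
    correct-length P n rs e fs ext = ≡.subst (_≤ length fs) (≡.trans (exec-length rs P) (≡.cong (ℕ._+ length P) e)) (⊑-length ext)

    correct-× : ∀ {P n} {Post₁ Post₂ : List K → Set} → Correct P n Post₁ → Correct P n Post₂ → Correct P n (λ fs → Post₁ fs × Post₂ fs)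
    correct-× c₁ c₂ rs e fs ext = c₁ rs e fs ext , c₂ rs e fs ext

    instr-correct : ∀ c n → Operands< c n → Correct (c ∷ []) n (λ fs → reg R fs n ≡ step R f fs c)
    instr-correct c n ops rs ≡.refl fs ext = ≡.trans (reg-⊑ ext n (≡.subst (n <_) (≡.sym (LP.length-++ rs)) (ℕP.m<m+n n (s≤s z≤n))))
      (≡.trans (reg-length rs _ []) (step-⊑ (⊑-trans (_ ∷ [] , ≡.refl) ext) c ops))

    addAll-correct : ∀ c I J n → (∀ t → t < c → (I t < n ℕ.+ t) × (J t < n ℕ.+ t)) →
      Correct (addAll c I J) n (λ fs → ∀ t → t < c → reg R fs (n ℕ.+ t) ≡ reg R fs (I t) + reg R fs (J t))
    addAll-correct zero I J n _ rs e fs ext t ()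
    addAll-correct (suc c) I J n bounds = correct-weaken {P = addAll (suc c) I J} combine
        (correct-++ {P = add (I 0) (J 0) ∷ []} {Q = addAll c (λ t → I (suc t)) (λ t → J (suc t))} (instr-correct (add (I 0) (J 0)) n (first-operands<))
          (addAll-correct c (λ t → I (suc t)) (λ t → J (suc t)) (n ℕ.+ 1) rest-operands<))
      where
      first-operands< : (I 0 < n) × (J 0 < n)
      first-operands< = let (i< , j<) = bounds 0 (s≤s z≤n) in
        ≡.subst (I 0 <_) (ℕP.+-identityʳ n) i< , ≡.subst (J 0 <_) (ℕP.+-identityʳ n) j<
      n+1+t : ∀ t → n ℕ.+ 1 ℕ.+ t ≡ n ℕ.+ suc t
      n+1+t t = ℕP.+-assoc n 1 t
      rest-operands< : ∀ t → t < c → (I (suc t) < n ℕ.+ 1 ℕ.+ t) × (J (suc t) < n ℕ.+ 1 ℕ.+ t)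
      rest-operands< t t<c = let (i< , j<) = bounds (suc t) (s≤s t<c) in
        ≡.subst (I (suc t) <_) (≡.sym (n+1+t t)) i< , ≡.subst (J (suc t) <_) (≡.sym (n+1+t t)) j<
      combine : ∀ fs → _ → ∀ t → t < suc c → reg R fs (n ℕ.+ t) ≡ reg R fs (I t) + reg R fs (J t)
      combine fs (first , rest) zero _ = ≡.trans (≡.cong (reg R fs) (ℕP.+-identityʳ n)) first
      combine fs (first , rest) (suc t) (s≤s t<c) = ≡.trans (≡.cong (reg R fs) (≡.sym (n+1+t t))) (rest t t<c)

    loadAll-correct : Correct (loadAll (λ j → j)) 0 (λ fs → ∀ j (j<N : j < N) → reg R fs j ≡ f (fromℕ< j<N))
    loadAll-correct [] ≡.refl fs ext j j<N =
      ≡.trans (reg-⊑ (≡.subst (_⊑ fs) (exec-loadAll (λ j → j) []) ext) j (≡.subst (j <_) (≡.sym (LP.length-tabulate f)) j<N))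
              (reg-tabulate f j j<N)

    sequenceGen-correct : ∀ c body n (Post : ℕ → (ℕ → ℕ) → List K → Set) →
      (∀ j → j < c → ∀ n' → n ≤ n' → Correct (proj₁ (body j n')) n' (Post j (proj₂ (body j n')))) →
      Correct (proj₁ (sequenceGen c body n)) n (λ fs → ∀ j → j < c → Post j (proj₂ (sequenceGen c body n) j) fs)
    sequenceGen-correct zero body n Post h rs e fs ext j ()
    sequenceGen-correct (suc c) body n Post h =
      correct-weaken {P = proj₁ (sequenceGen (suc c) body n)}
        (λ fs post → λ { zero _ → proj₁ post ; (suc j) (s≤s j<c) → proj₂ post j j<c })
        (correct-++ {P = proj₁ (body 0 n)} (h 0 (s≤s z≤n) n ℕP.≤-refl)
          (sequenceGen-correct c (λ j → body (suc j)) _ (λ j → Post (suc j))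
            (λ j j<c n' n≤n' → h (suc j) (s≤s j<c) n' (ℕP.≤-trans (ℕP.m≤m+n n _) n≤n'))))

module Expansion (R : CommutativeRing 0ℓ 0ℓ) (char2 : Char2 R) (N : ℕ) where
  open CommutativeRing R renaming (Carrier to K)
  open CharTwo R char2
  open Programs R N

  blockSize : ℕ → ℕ
  blockSize r = 2 ℕ.^ (2 ℕ.^ r)

  blockSize≥2 : ∀ r → 2 ≤ blockSize r
  blockSize≥2 r = ℕP.^-monoʳ-≤ 2 {1} {2 ℕ.^ r} (ℕP.m^n>0 2 r)

  σ^2^d : ∀ r d x → σ r x ^ (2 ℕ.^ d) ≈ x ^ (blockSize r ℕ.* 2 ℕ.^ d) + x ^ (2 ℕ.^ d)
  σ^2^d r d x = trans (frobenius d _ _) (+-congʳ (sym (^-*-assoc x (blockSize r) (2 ℕ.^ d))))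

  IsExpansion : ℕ → ℕ → (ℕ → ℕ) → (ℕ → ℕ) → List K → Set
  IsExpansion r d inF out fs = (∀ p → p < blockSize r ℕ.* 2 ℕ.^ d → out p < length fs) ×
    (∀ x → poly (blockSize r ℕ.* 2 ℕ.^ d) (λ j → reg R fs (inF j)) x ≈
           poly (2 ℕ.^ d) (λ i → poly (blockSize r) (λ j → reg R fs (out (i ℕ.* blockSize r ℕ.+ j))) x) (σ r x))

  -- One step of the expansion in powers of σ r: the input (degree < 2M, registers inF) is divided by
  -- σ r ^ D = X^M + X^D, and quotient and remainder (degree < M) are expanded by rec.
  module ExpandStep (rec : (ℕ → ℕ) → ℕ → OutProgram) (r d : ℕ) (inF : ℕ → ℕ) (n : ℕ) where
    b = blockSize r
    D = 2 ℕ.^ d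
    M = b ℕ.* D
    F = M ∸ (D ℕ.+ D)
    E = D ℕ.+ F
    sums = addAll D (λ t → inF (M ℕ.+ t)) (λ t → inF (M ℕ.+ E ℕ.+ t))
    quot : ℕ → ℕ
    quot t = if t <ᵇ D then n ℕ.+ t else inF (M ℕ.+ t)
    rems = addAll E (λ u → inF (D ℕ.+ u)) quot
    rem : ℕ → ℕ
    rem j = if j <ᵇ D then inF j else n ℕ.+ length sums ℕ.+ (j ∸ D)
    n₁ = n ℕ.+ length sums ℕ.+ length rems
    low = rec rem n₁
    high = rec quot (n₁ ℕ.+ length (proj₁ low))
    result : OutProgram
    result = sums ++ (rems ++ (proj₁ low ++ proj₁ high)) ,
             (λ p → if p <ᵇ M then proj₂ low p else proj₂ high (p ∸ M))

    M≡D+E : M ≡ D ℕ.+ E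
    M≡D+E = ≡.trans (≡.sym (ℕP.m+[n∸m]≡n (≡.subst (_≤ M) (2*≡+ D) (ℕP.*-monoˡ-≤ D (blockSize≥2 r))))) (ℕP.+-assoc D D F)

    size≡M+M : b ℕ.* 2 ℕ.^ suc d ≡ M ℕ.+ M
    size≡M+M = ≡.trans (≡.cong (b ℕ.*_) (2*≡+ D)) (ℕP.*-distribˡ-+ b D D)

    module _ (inF< : ∀ j → j < b ℕ.* 2 ℕ.^ suc d → inF j < n) where

      inF-low< : ∀ t → t < M → inF t < n
      inF-low< t t<M = inF< t (≡.subst (t <_) (≡.sym size≡M+M) (ℕP.<-≤-trans t<M (ℕP.m≤m+n M M)))

      inF-high< : ∀ t → t < M → inF (M ℕ.+ t) < n
      inF-high< t t<M = inF< (M ℕ.+ t) (≡.subst (M ℕ.+ t <_) (≡.sym size≡M+M) (ℕP.+-monoʳ-< M t<M))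

      sums-operands< : ∀ t → t < D → (inF (M ℕ.+ t) < n ℕ.+ t) × (inF (M ℕ.+ E ℕ.+ t) < n ℕ.+ t)
      sums-operands< t t<D =
        ℕP.<-≤-trans (inF-high< t (ℕP.<-≤-trans t<D (≡.subst (D ≤_) (≡.sym M≡D+E) (ℕP.m≤m+n D E)))) (ℕP.m≤m+n n t) ,
        ℕP.<-≤-trans (≡.subst (λ z → inF z < n) (≡.sym (ℕP.+-assoc M E t))
          (inF-high< (E ℕ.+ t) (≡.subst (E ℕ.+ t <_) (≡.sym (≡.trans M≡D+E (ℕP.+-comm D E))) (ℕP.+-monoʳ-< E t<D))))
          (ℕP.m≤m+n n t)

      quot< : ∀ t k → t < M → quot t < n ℕ.+ length sums ℕ.+ k
      quot< t k t<M with t ℕP.<? D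
      ... | yes t<D = ≡.subst (_< n ℕ.+ length sums ℕ.+ k) (≡.sym (if-<ᵇ-yes t<D))
        (ℕP.<-≤-trans (ℕP.+-monoʳ-< n (≡.subst (t <_) (≡.sym (addAll-length D _ _)) t<D)) (ℕP.m≤m+n _ k))
      ... | no t≮D = ≡.subst (_< n ℕ.+ length sums ℕ.+ k) (≡.sym (if-<ᵇ-no (ℕP.≮⇒≥ t≮D)))
        (ℕP.<-≤-trans (inF-high< t t<M) (ℕP.≤-trans (ℕP.m≤m+n n (length sums)) (ℕP.m≤m+n _ k)))

      rems-operands< : ∀ u → u < E → (inF (D ℕ.+ u) < n ℕ.+ length sums ℕ.+ u) × (quot u < n ℕ.+ length sums ℕ.+ u)
      rems-operands< u u<E =
        ℕP.<-≤-trans (inF-low< (D ℕ.+ u) (≡.subst (D ℕ.+ u <_) (≡.sym M≡D+E) (ℕP.+-monoʳ-< D u<E)))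
          (ℕP.≤-trans (ℕP.m≤m+n n (length sums)) (ℕP.m≤m+n _ u)) ,
        quot< u u (ℕP.<-≤-trans u<E (≡.subst (E ≤_) (≡.sym M≡D+E) (ℕP.m≤n+m E D)))

      rem<n₁ : ∀ j → j < M → rem j < n₁
      rem<n₁ j j<M with j ℕP.<? D
      ... | yes j<D = ≡.subst (_< n₁) (≡.sym (if-<ᵇ-yes j<D))
        (ℕP.<-≤-trans (inF-low< j j<M) (ℕP.≤-trans (ℕP.m≤m+n n (length sums)) (ℕP.m≤m+n _ (length rems))))
      ... | no j≮D = ≡.subst (_< n₁) (≡.sym (if-<ᵇ-no (ℕP.≮⇒≥ j≮D)))
        (ℕP.+-monoʳ-< (n ℕ.+ length sums) (≡.subst (j ∸ D <_) (≡.sym (addAll-length E _ _))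
          (ℕP.+-cancelˡ-< D (j ∸ D) E (≡.subst (_< D ℕ.+ E) (≡.sym (ℕP.m+[n∸m]≡n (ℕP.≮⇒≥ j≮D))) (≡.subst (j <_) M≡D+E j<M)))))


    merge-expansions : ∀ fs →
      (∀ t → t < D → reg R fs (n ℕ.+ t) ≡ reg R fs (inF (M ℕ.+ t)) + reg R fs (inF (M ℕ.+ E ℕ.+ t))) ×
      ((∀ u → u < E → reg R fs (n ℕ.+ length sums ℕ.+ u) ≡ reg R fs (inF (D ℕ.+ u)) + reg R fs (quot u)) ×
       (IsExpansion r d rem (proj₂ low) fs × IsExpansion r d quot (proj₂ high) fs)) →
      IsExpansion r (suc d) inF (proj₂ result) fs
    merge-expansions fs (sums≡ , rems≡ , low-exp , high-exp) = bounds , identity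
      where
      open import Relation.Binary.Reasoning.Setoid setoid
      ρ = reg R fs
      out = proj₂ result
      c = λ j → ρ (inF j)
      bounds : ∀ p → p < b ℕ.* 2 ℕ.^ suc d → out p < length fs
      bounds p p< with p ℕP.<? M
      ... | yes p<M = ≡.subst (_< length fs) (≡.sym (if-<ᵇ-yes p<M)) (proj₁ low-exp p p<M)
      ... | no p≮M = ≡.subst (_< length fs) (≡.sym (if-<ᵇ-no (ℕP.≮⇒≥ p≮M)))
        (proj₁ high-exp (p ∸ M) (ℕP.+-cancelˡ-< M (p ∸ M) M (≡.subst (_< M ℕ.+ M) (≡.sym (ℕP.m+[n∸m]≡n (ℕP.≮⇒≥ p≮M)))
          (≡.subst (p <_) size≡M+M p<))))
      quot-low : ∀ t → t < D → ρ (quot t) ≈ c (M ℕ.+ t) + c (M ℕ.+ E ℕ.+ t)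
      quot-low t t<D = reflexive (≡.trans (≡.cong ρ (if-<ᵇ-yes t<D)) (sums≡ t t<D))
      quot-high : ∀ t → D ≤ t → t < M → ρ (quot t) ≈ c (M ℕ.+ t)
      quot-high t D≤t _ = reflexive (≡.cong ρ (if-<ᵇ-no D≤t))
      rem-low : ∀ j → j < D → ρ (rem j) ≈ c j
      rem-low j j<D = reflexive (≡.cong ρ (if-<ᵇ-yes j<D))
      rem-high : ∀ u → u < E → ρ (rem (D ℕ.+ u)) ≈ c (D ℕ.+ u) + ρ (quot u)
      rem-high u u<E = reflexive (≡.trans (≡.cong ρ (≡.trans (if-<ᵇ-no (ℕP.m≤m+n D u))
        (≡.cong (n ℕ.+ length sums ℕ.+_) (ℕP.m+n∸m≡n D u)))) (rems≡ u u<E))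
      G G₀ G₁ : K → ℕ → K
      G x i = poly b (λ j → ρ (out (i ℕ.* b ℕ.+ j))) x
      G₀ x i = poly b (λ j → ρ (proj₂ low (i ℕ.* b ℕ.+ j))) x
      G₁ x i = poly b (λ j → ρ (proj₂ high (i ℕ.* b ℕ.+ j))) x
      G-low : ∀ x i → i < D → G x i ≈ G₀ x i
      G-low x i i<D = poly-cong b (λ j j<b → reflexive (≡.cong ρ (if-<ᵇ-yes (block-index< b D i j i<D j<b)))) refl
      G-high : ∀ x i → i < D → G x (D ℕ.+ i) ≈ G₁ x i
      G-high x i _ = poly-cong b (λ j _ → reflexive (≡.cong ρ (≡.trans (≡.cong out (block-index-shift b D i j))
        (≡.trans (if-<ᵇ-no (ℕP.m≤m+n M _)) (≡.cong (proj₂ high) (ℕP.m+n∸m≡n M _)))))) refl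
      identity : ∀ x → poly (b ℕ.* 2 ℕ.^ suc d) c x ≈ poly (2 ℕ.^ suc d) (G x) (σ r x)
      identity x = begin
        poly (b ℕ.* 2 ℕ.^ suc d) c x            ≈⟨ poly-congˡ size≡M+M c x ⟩
        poly (M ℕ.+ M) c x
          ≈⟨ poly-divMod D F M M≡D+E c (λ j → ρ (rem j)) (λ j → ρ (quot j)) quot-low quot-high rem-low rem-high x ⟩
        poly M (λ j → ρ (rem j)) x + (x ^ D * x ^ E + x ^ D) * poly M (λ j → ρ (quot j)) x
          ≈⟨ +-cong (proj₂ low-exp x) (*-cong divisor≈σ^D (proj₂ high-exp x)) ⟩
        poly D (G₀ x) (σ r x) + σ r x ^ D * poly D (G₁ x) (σ r x)
          ≈⟨ sym (poly-halves D (G x) (G₀ x) (G₁ x) (σ r x) (G-low x) (G-high x)) ⟩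
        poly (D ℕ.+ D) (G x) (σ r x)            ≈⟨ poly-congˡ (≡.sym (2*≡+ D)) (G x) (σ r x) ⟩
        poly (2 ℕ.^ suc d) (G x) (σ r x)        ∎
        where
        divisor≈σ^D : x ^ D * x ^ E + x ^ D ≈ σ r x ^ D
        divisor≈σ^D = sym (trans (σ^2^d r d x) (+-congʳ (trans (^-congʳ x M≡D+E) (^-distribˡ-+-* x D E))))

  expand : ℕ → ℕ → (ℕ → ℕ) → ℕ → OutProgram
  expand r zero inF n = [] , inF
  expand r (suc d) inF n = ExpandStep.result (expand r d) r d inF n

  expand-additions : ∀ r d inF n → 2 ℕ.* additions R (proj₁ (expand r d inF n)) ≤ d ℕ.* (blockSize r ℕ.* 2 ℕ.^ d)
  expand-additions r zero inF n = z≤n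
  expand-additions r (suc d) inF n = begin
    2 ℕ.* additions R (sums ++ (rems ++ (proj₁ low ++ proj₁ high)))
      ≡⟨ ≡.cong (2 ℕ.*_) count ⟩
    2 ℕ.* (D ℕ.+ (E ℕ.+ (A₀ ℕ.+ A₁)))          ≡⟨ regroup D E A₀ A₁ ⟩
    2 ℕ.* (D ℕ.+ E) ℕ.+ (2 ℕ.* A₀ ℕ.+ 2 ℕ.* A₁) ≤⟨ ℕP.+-mono-≤ (ℕP.≤-reflexive (≡.cong (2 ℕ.*_) (≡.sym M≡D+E)))
                                                   (ℕP.+-mono-≤ (expand-additions r d rem n₁) (expand-additions r d quot _)) ⟩
    2 ℕ.* M ℕ.+ (d ℕ.* M ℕ.+ d ℕ.* M)          ≡⟨ total b D d ⟩
    suc d ℕ.* (b ℕ.* 2 ℕ.^ suc d)              ∎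
    where
    open ExpandStep (expand r d) r d inF n
    open ℕP.≤-Reasoning
    A₀ = additions R (proj₁ low)
    A₁ = additions R (proj₁ high)
    count : additions R (sums ++ (rems ++ (proj₁ low ++ proj₁ high))) ≡ D ℕ.+ (E ℕ.+ (A₀ ℕ.+ A₁))
    count = ≡.trans (additions-++ sums _) (≡.cong₂ ℕ._+_ (addAll-additions D _ _)
      (≡.trans (additions-++ rems _) (≡.cong₂ ℕ._+_ (addAll-additions E _ _) (additions-++ (proj₁ low) _))))
    regroup : ∀ D E A₀ A₁ → 2 ℕ.* (D ℕ.+ (E ℕ.+ (A₀ ℕ.+ A₁))) ≡ 2 ℕ.* (D ℕ.+ E) ℕ.+ (2 ℕ.* A₀ ℕ.+ 2 ℕ.* A₁)
    regroup = solve-∀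
    total : ∀ b D d → 2 ℕ.* (b ℕ.* D) ℕ.+ (d ℕ.* (b ℕ.* D) ℕ.+ d ℕ.* (b ℕ.* D)) ≡ suc d ℕ.* (b ℕ.* (2 ℕ.* D))
    total = solve-∀

  module _ (f : Fin N → K) where
    open Semantics f

    expand-correct : ∀ r d inF n → (∀ j → j < blockSize r ℕ.* 2 ℕ.^ d → inF j < n) →
      Correct (proj₁ (expand r d inF n)) n (IsExpansion r d inF (proj₂ (expand r d inF n)))
    expand-correct r zero inF n inF< rs e fs ext =
      (λ p p< → ℕP.<-≤-trans (inF< p p<) (≡.subst (_≤ length fs) e (⊑-length ext))) ,
      (λ x → trans (poly-congˡ (ℕP.*-identityʳ (blockSize r)) _ x) (sym (trans (+-identityˡ _) (*-identityʳ _))))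
    expand-correct r (suc d) inF n inF< = correct-weaken {P = proj₁ result} merge-expansions
      (correct-++ {P = sums} (addAll-correct D _ _ n (sums-operands< inF<))
      (correct-++ {P = rems} (addAll-correct E _ _ (n ℕ.+ length sums) (rems-operands< inF<))
      (correct-++ {P = proj₁ low} (expand-correct r d rem n₁ (rem<n₁ inF<))
        (expand-correct r d quot _ (λ t t<M → ℕP.<-≤-trans (quot< inF< t (length rems) t<M) (ℕP.m≤m+n n₁ _))))))
      where open ExpandStep (expand r d) r d inF n

module Evaluation (R : CommutativeRing 0ℓ 0ℓ) (char2 : Char2 R) (N : ℕ) (β : ℕ → CommutativeRing.Carrier R) where
  open CommutativeRing R renaming (Carrier to K)
  open CharTwo R char2
  open Programs R N
  open Expansion R char2 N

  Evaluator : Set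
  Evaluator = ℕ → K → (ℕ → ℕ) → ℕ → OutProgram

  -- The two values c₀ + a c₁ and (c₀ + a c₁) + c₁ at a and a + 1.
  evalBase : K → (ℕ → ℕ) → ℕ → OutProgram
  evalBase a inF n =
    const a ∷ mul n (inF 1) ∷ add (inF 0) (n ℕ.+ 1) ∷ add (n ℕ.+ 1 ℕ.+ 1) (inF 1) ∷ [] ,
    λ { zero → n ℕ.+ 1 ℕ.+ 1 ; (suc _) → n ℕ.+ 1 ℕ.+ 1 ℕ.+ 1 }

  -- Points a + ϖ_i with i = hi · 2^s + lo: evaluate the σ r-expansion coefficients at σ r a + ϖ_hi,
  -- then each small polynomial on the coset a + ϖ_{hi·2^s} + W_s.
  module EvalSplit (rec : Evaluator) (r m : ℕ) (a : K) (inF : ℕ → ℕ) (n : ℕ) where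
    s = 2 ℕ.^ r
    k = m ∸ s
    b = blockSize r
    expansion = expand r k inF n
    n₁ = n ℕ.+ length (proj₁ expansion)
    coefficientReg : ℕ → ℕ → ℕ
    coefficientReg j i = proj₂ expansion (i ℕ.* b ℕ.+ j)
    inner : ℕ → ℕ → OutProgram
    inner j = rec k (σ r a) (coefficientReg j)
    inners = sequenceGen b inner n₁
    n₂ = n₁ ℕ.+ length (proj₁ inners)
    cosetBase : ℕ → K
    cosetBase hi = a + varpi R k (λ u → β (s ℕ.+ u)) hi
    outer : ℕ → ℕ → OutProgram
    outer hi = rec s (cosetBase hi) (λ j → proj₂ inners j hi)
    outers = sequenceGen (2 ℕ.^ k) outer n₂
    result : OutProgram
    result = proj₁ expansion ++ (proj₁ inners ++ proj₁ outers) ,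
             (λ i → proj₂ outers ((i DM./ b) {{2^≢0 s}}) ((i DM.% b) {{2^≢0 s}}))

    module _ (s<m : s < m) (m≤2s : m ≤ 2 ℕ.^ suc r) where
      s+k≡m : s ℕ.+ k ≡ m
      s+k≡m = ℕP.m+[n∸m]≡n (ℕP.<⇒≤ s<m)

      k≤s : k ≤ s
      k≤s = ℕP.+-cancelˡ-≤ s k s (≡.subst (_≤ s ℕ.+ s) (≡.sym s+k≡m) (≡.subst (m ≤_) (2*≡+ s) m≤2s))

      1≤k : 1 ≤ k
      1≤k = ℕP.+-cancelˡ-≤ s 1 k (≡.subst (s ℕ.+ 1 ≤_) (≡.sym s+k≡m) (≡.subst (_≤ m) (ℕP.+-comm 1 s) s<m))

      2^m≡b*2^k : 2 ℕ.^ m ≡ b ℕ.* 2 ℕ.^ k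
      2^m≡b*2^k = ≡.trans (≡.cong (2 ℕ.^_) (≡.sym s+k≡m)) (ℕP.^-distribˡ-+-* 2 s k)

  splitIf : Bool → Evaluator → ℕ → Evaluator
  splitIf true rec r m = EvalSplit.result rec r m
  splitIf false rec r m = rec m

  evaluate : ℕ → Evaluator
  evaluate zero m = evalBase
  evaluate (suc r) m = splitIf (2 ℕ.^ r <ᵇ m) (evaluate r) r m

  evaluate-additions : ∀ r m a inF n → 1 ≤ m → m ≤ 2 ℕ.^ r →
    2 ℕ.* additions R (proj₁ (evaluate r m a inF n)) ≤ 2 ℕ.^ m ℕ.* m ℕ.* (2 ℕ.+ r)
  evaluate-additions zero (suc zero) a inF n _ _ = ℕP.≤-refl
  evaluate-additions zero (suc (suc m)) a inF n _ (s≤s ())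
  evaluate-additions (suc r) m a inF n 1≤m m≤2^[1+r] = by-cases (2 ℕ.^ r <ᵇ m) ≡.refl
    where
    by-cases : ∀ split? → (2 ℕ.^ r <ᵇ m) ≡ split? →
      2 ℕ.* additions R (proj₁ (splitIf split? (evaluate r) r m a inF n)) ≤ 2 ℕ.^ m ℕ.* m ℕ.* (2 ℕ.+ suc r)
    by-cases false eq = ℕP.≤-trans (evaluate-additions r m a inF n 1≤m (<ᵇ-false⇒≥ eq))
      (ℕP.*-monoʳ-≤ (2 ℕ.^ m ℕ.* m) (ℕP.n≤1+n (2 ℕ.+ r)))
    by-cases true eq = begin
      2 ℕ.* additions R (proj₁ expansion ++ (proj₁ inners ++ proj₁ outers))   ≡⟨ count ⟩
      2 ℕ.* A₁ ℕ.+ (2 ℕ.* A₂ ℕ.+ 2 ℕ.* A₃)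
        ≤⟨ ℕP.+-mono-≤ (expand-additions r k inF n) (ℕP.+-mono-≤
             (sequenceGen-additions b inner n₁ _ (λ _ _ n' → evaluate-additions r k (σ r a) _ n' (1≤k s<m m≤2^[1+r]) (k≤s s<m m≤2^[1+r])))
             (sequenceGen-additions (2 ℕ.^ k) outer n₂ _ (λ _ _ n' → evaluate-additions r s _ _ n' (ℕP.m^n>0 2 r) ℕP.≤-refl))) ⟩
      k ℕ.* (b ℕ.* 2 ℕ.^ k) ℕ.+ (b ℕ.* (2 ℕ.^ k ℕ.* k ℕ.* (2 ℕ.+ r)) ℕ.+ 2 ℕ.^ k ℕ.* (b ℕ.* s ℕ.* (2 ℕ.+ r)))
        ≡⟨ regroup b (2 ℕ.^ k) k s r ⟩
      b ℕ.* 2 ℕ.^ k ℕ.* (k ℕ.+ (s ℕ.+ k) ℕ.* (2 ℕ.+ r))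
        ≤⟨ ℕP.*-monoʳ-≤ (b ℕ.* 2 ℕ.^ k) (ℕP.+-monoˡ-≤ ((s ℕ.+ k) ℕ.* (2 ℕ.+ r)) (ℕP.m≤n+m k s)) ⟩
      b ℕ.* 2 ℕ.^ k ℕ.* ((s ℕ.+ k) ℕ.+ (s ℕ.+ k) ℕ.* (2 ℕ.+ r))  ≡⟨ factor (b ℕ.* 2 ℕ.^ k) (s ℕ.+ k) r ⟩
      b ℕ.* 2 ℕ.^ k ℕ.* (s ℕ.+ k) ℕ.* (3 ℕ.+ r)
        ≡⟨ ≡.cong₂ (λ A B → A ℕ.* B ℕ.* (3 ℕ.+ r)) (≡.sym (2^m≡b*2^k s<m m≤2^[1+r])) (s+k≡m s<m m≤2^[1+r]) ⟩
      2 ℕ.^ m ℕ.* m ℕ.* (3 ℕ.+ r)  ∎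
      where
      open EvalSplit (evaluate r) r m a inF n
      open ℕP.≤-Reasoning
      s<m = <ᵇ-true⇒< eq
      A₁ = additions R (proj₁ expansion)
      A₂ = additions R (proj₁ inners)
      A₃ = additions R (proj₁ outers)
      count : 2 ℕ.* additions R (proj₁ expansion ++ (proj₁ inners ++ proj₁ outers)) ≡ 2 ℕ.* A₁ ℕ.+ (2 ℕ.* A₂ ℕ.+ 2 ℕ.* A₃)
      count = ≡.trans (≡.cong (2 ℕ.*_) (≡.trans (additions-++ (proj₁ expansion) _) (≡.cong (A₁ ℕ.+_) (additions-++ (proj₁ inners) _))))
        (double-+³ A₁ A₂ A₃)
        where
        double-+³ : ∀ a b c → 2 ℕ.* (a ℕ.+ (b ℕ.+ c)) ≡ 2 ℕ.* a ℕ.+ (2 ℕ.* b ℕ.+ 2 ℕ.* c)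
        double-+³ = solve-∀
      regroup : ∀ b P k s r → k ℕ.* (b ℕ.* P) ℕ.+ (b ℕ.* (P ℕ.* k ℕ.* (2 ℕ.+ r)) ℕ.+ P ℕ.* (b ℕ.* s ℕ.* (2 ℕ.+ r)))
                              ≡ b ℕ.* P ℕ.* (k ℕ.+ (s ℕ.+ k) ℕ.* (2 ℕ.+ r))
      regroup = solve-∀
      factor : ∀ B m r → B ℕ.* (m ℕ.+ m ℕ.* (2 ℕ.+ r)) ≡ B ℕ.* m ℕ.* (3 ℕ.+ r)
      factor = solve-∀

  Evaluates : ℕ → K → (ℕ → ℕ) → (ℕ → ℕ) → List K → Set
  Evaluates m a inF out fs = ∀ i → i < 2 ℕ.^ m →
    (out i < length fs) × (reg R fs (out i) ≈ poly (2 ℕ.^ m) (λ j → reg R fs (inF j)) (a + varpi R m β i))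

  module _ (f : Fin N → K) (nβ : ℕ) (β0≈1 : β 0 ≈ 1#)
           (β-step : ∀ t → suc t < nβ → (β (suc t) * β (suc t)) - β (suc t) ≈ β t) where
    open Semantics f
    open CantorBasis β nβ β0≈1 β-step
    open import Algebra.Solver.Ring.NaturalCoefficients.Default commutativeSemiring
      using (solve; _:=_; _:+_; _:*_; con)

    evalBase-correct : ∀ a inF n → (∀ j → j < 2 → inF j < n) →
      Correct (proj₁ (evalBase a inF n)) n (Evaluates 1 a inF (proj₂ (evalBase a inF n)))
    evalBase-correct a inF n inF< = correct-weaken {P = proj₁ (evalBase a inF n)} values
      (correct-++ {P = const a ∷ []} {Q = mul n (inF 1) ∷ add (inF 0) n₁ ∷ add n₂ (inF 1) ∷ []} (instr-correct (const a) n _)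
      (correct-++ {P = mul n (inF 1) ∷ []} {Q = add (inF 0) n₁ ∷ add n₂ (inF 1) ∷ []} (instr-correct (mul n (inF 1)) n₁ (n<n+1 , up inF1<n))
      (correct-++ {P = add (inF 0) n₁ ∷ []} {Q = add n₂ (inF 1) ∷ []} (instr-correct (add (inF 0) n₁) n₂ (up (up inF0<n) , n₁ <+1))
      (correct-× {P = add n₂ (inF 1) ∷ []} (instr-correct (add n₂ (inF 1)) n₃ (n₂ <+1 , up (up (up inF1<n))))
                                            (correct-length (add n₂ (inF 1) ∷ []) n₃)))))
      where
      open import Relation.Binary.Reasoning.Setoid setoid
      n₁ = n ℕ.+ 1
      n₂ = n₁ ℕ.+ 1
      n₃ = n₂ ℕ.+ 1
      _<+1 : ∀ x → x < x ℕ.+ 1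
      x <+1 = ℕP.m<m+n x (s≤s z≤n)
      n<n+1 = n <+1
      inF0<n = inF< 0 (s≤s z≤n)
      inF1<n = inF< 1 (s≤s (s≤s z≤n))
      up : ∀ {x y} → x < y → x < y ℕ.+ 1
      up {y = y} x<y = ℕP.<-≤-trans x<y (ℕP.m≤m+n y 1)
      values : ∀ fs → _ → Evaluates 1 a inF (proj₂ (evalBase a inF n)) fs
      values fs (ρn≡a , ρn₁≡ , ρn₂≡ , ρn₃≡ , length≥) = λ
        { zero _ → ℕP.<-≤-trans (ℕP.<-trans (n₂ <+1) (n₃ <+1)) length≥ , at-a
        ; (suc zero) _ → ℕP.<-≤-trans (n₃ <+1) length≥ , at-a+1
        ; (suc (suc _)) (s≤s (s≤s ())) }
        where
        ρ = reg R fs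
        c₀ = ρ (inF 0)
        c₁ = ρ (inF 1)
        ρn₂≈ : ρ n₂ ≈ c₀ + a * c₁
        ρn₂≈ = reflexive (≡.trans ρn₂≡ (≡.cong (c₀ +_) (≡.trans ρn₁≡ (≡.cong (_* c₁) ρn≡a))))
        at-a : ρ n₂ ≈ poly 2 (λ j → ρ (inF j)) (a + varpi R 1 β 0)
        at-a = trans ρn₂≈ (solve 3 (λ c₀ c₁ a → c₀ :+ a :* c₁ :=
          (con 0 :+ c₀ :* con 1) :+ c₁ :* (con 1 :* (a :+ (con 0 :+ con 0)))) refl c₀ c₁ a)
        at-a+1 : ρ n₃ ≈ poly 2 (λ j → ρ (inF j)) (a + varpi R 1 β 1)
        at-a+1 = begin
          ρ n₃                            ≈⟨ trans (reflexive ρn₃≡) (+-congʳ ρn₂≈) ⟩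
          (c₀ + a * c₁) + c₁              ≈⟨ solve 3 (λ c₀ c₁ a → (c₀ :+ a :* c₁) :+ c₁ :=
                                               (con 0 :+ c₀ :* con 1) :+ c₁ :* (con 1 :* (a :+ (con 0 :+ con 1)))) refl c₀ c₁ a ⟩
          (0# + c₀ * 1#) + c₁ * (1# * (a + (0# + 1#)))   ≈⟨ +-congˡ (*-congˡ (*-congˡ (+-congˡ (+-congˡ (sym β0≈1))))) ⟩
          poly 2 (λ j → ρ (inF j)) (a + varpi R 1 β 1) ∎

    module _ (rec : Evaluator) (r m : ℕ) (a : K) (inF : ℕ → ℕ) (n : ℕ) where
      open EvalSplit rec r m a inF n

      evalSplit-merge : s < m → m ≤ 2 ℕ.^ suc r → m ≤ nβ → ∀ fs →
        IsExpansion r k inF (proj₂ expansion) fs ×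
        ((∀ j → j < b → Evaluates k (σ r a) (coefficientReg j) (proj₂ inners j) fs) ×
         (∀ hi → hi < 2 ℕ.^ k → Evaluates s (cosetBase hi) (λ j → proj₂ inners j hi) (proj₂ outers hi) fs)) →
        Evaluates m a inF (proj₂ result) fs
      evalSplit-merge s<m m≤2s m≤nβ fs (expanded , inner-values , outer-values) i i<2^m =
        proj₁ (outer-values hi hi< lo lo<) , value
        where
        open import Relation.Binary.Reasoning.Setoid setoid
        ρ = reg R fs
        c = λ j → ρ (inF j)
        e = λ i j → ρ (proj₂ expansion (i ℕ.* b ℕ.+ j))
        hi = (i DM./ b) {{2^≢0 s}}
        lo = (i DM.% b) {{2^≢0 s}}
        hi< : hi < 2 ℕ.^ k
        hi< = DM.m<n*o⇒m/o<n {{2^≢0 s}} (≡.subst (i <_) (≡.trans (2^m≡b*2^k s<m m≤2s) (ℕP.*-comm b _)) i<2^m)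
        lo< : lo < b
        lo< = DM.m%n<n i b {{2^≢0 s}}
        x = cosetBase hi + varpi R s β lo
        x≈ : x ≈ a + varpi R m β i
        x≈ = begin
          (a + varpi R k _ hi) + varpi R s β lo  ≈⟨ +-assoc _ _ _ ⟩
          a + (varpi R k _ hi + varpi R s β lo)  ≈⟨ +-congˡ (+-comm _ _) ⟩
          a + (varpi R s β lo + varpi R k _ hi)  ≈⟨ +-congˡ (sym (varpi-+ s k i β)) ⟩
          a + varpi R (s ℕ.+ k) β i              ≈⟨ +-congˡ (reflexive (≡.cong (λ z → varpi R z β i) (s+k≡m s<m m≤2s))) ⟩
          a + varpi R m β i                      ∎
        value : ρ (proj₂ outers hi lo) ≈ poly (2 ℕ.^ m) c (a + varpi R m β i)
        value = begin
          ρ (proj₂ outers hi lo)                            ≈⟨ proj₂ (outer-values hi hi< lo lo<) ⟩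
          poly b (λ j → ρ (proj₂ inners j hi)) x            ≈⟨ poly-cong b (λ j j<b → trans (proj₂ (inner-values j j<b hi hi<))
              (poly-cong (2 ℕ.^ k) (λ _ _ → refl) (sym (σ-coset r k (≡.subst (_≤ nβ) (≡.sym (s+k≡m s<m m≤2s)) m≤nβ) a hi lo)))) refl ⟩
          poly b (λ j → poly (2 ℕ.^ k) (λ i → e i j) (σ r x)) x  ≈⟨ poly-poly b (2 ℕ.^ k) e x (σ r x) ⟩
          poly (2 ℕ.^ k) (λ i → poly b (e i) x) (σ r x)      ≈⟨ sym (proj₂ expanded x) ⟩
          poly (b ℕ.* 2 ℕ.^ k) c x                          ≈⟨ poly-congˡ (≡.sym (2^m≡b*2^k s<m m≤2s)) c x ⟩
          poly (2 ℕ.^ m) c x                                ≈⟨ poly-cong (2 ℕ.^ m) (λ _ _ → refl) x≈ ⟩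
          poly (2 ℕ.^ m) c (a + varpi R m β i)              ∎

    EvaluatorCorrect : Evaluator → ℕ → Set
    EvaluatorCorrect rec r = ∀ m a inF n → 1 ≤ m → m ≤ 2 ℕ.^ r → m ≤ nβ → (∀ j → j < 2 ℕ.^ m → inF j < n) →
      Correct (proj₁ (rec m a inF n)) n (Evaluates m a inF (proj₂ (rec m a inF n)))

    evalSplit-correct : ∀ rec r → EvaluatorCorrect rec r → ∀ m a inF n → 2 ℕ.^ r < m → m ≤ 2 ℕ.^ suc r → m ≤ nβ →
      (∀ j → j < 2 ℕ.^ m → inF j < n) →
      Correct (proj₁ (EvalSplit.result rec r m a inF n)) n (Evaluates m a inF (proj₂ (EvalSplit.result rec r m a inF n)))
    evalSplit-correct rec r rec-correct m a inF n s<m m≤2s m≤nβ inF< rs e =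
      correct-weaken {P = proj₁ result} (evalSplit-merge rec r m a inF n s<m m≤2s m≤nβ)
        (correct-++ {P = proj₁ expansion} expansion-correct (correct-++ {P = proj₁ inners} inners-correct outers-correct)) rs e
      where
      open EvalSplit rec r m a inF n
      expansion-correct : Correct (proj₁ expansion) n (IsExpansion r k inF (proj₂ expansion))
      expansion-correct = expand-correct f r k inF n (λ j j< → inF< j (≡.subst (j <_) (≡.sym (2^m≡b*2^k s<m m≤2s)) j<))
      rs₁ = exec rs (proj₁ expansion)
      |rs₁| : length rs₁ ≡ n₁
      |rs₁| = ≡.trans (exec-length rs (proj₁ expansion)) (≡.cong (ℕ._+ length (proj₁ expansion)) e)
      coefficient< : ∀ i j → i < 2 ℕ.^ k → j < b → proj₂ expansion (i ℕ.* b ℕ.+ j) < n₁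
      coefficient< i j i< j< = ≡.subst (_ <_) |rs₁|
        (proj₁ (correct-exec {P = proj₁ expansion} expansion-correct rs e) _ (block-index< b (2 ℕ.^ k) i j i< j<))
      inners-correct : Correct (proj₁ inners) n₁ (λ fs → ∀ j → j < b →
        Evaluates k (σ r a) (coefficientReg j) (proj₂ inners j) fs)
      inners-correct = sequenceGen-correct b inner n₁ (λ j → Evaluates k (σ r a) (coefficientReg j)) (λ j j<b n' n₁≤n' →
        rec-correct k (σ r a) (coefficientReg j) n' (1≤k s<m m≤2s) (k≤s s<m m≤2s) (ℕP.≤-trans (ℕP.m∸n≤m m s) m≤nβ)
          (λ i i< → ℕP.<-≤-trans (coefficient< i j i< j<b) n₁≤n'))
      |rs₂| : length (exec rs₁ (proj₁ inners)) ≡ n₂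
      |rs₂| = ≡.trans (exec-length rs₁ (proj₁ inners)) (≡.cong (ℕ._+ length (proj₁ inners)) |rs₁|)
      outers-correct : Correct (proj₁ outers) n₂ (λ fs → ∀ hi → hi < 2 ℕ.^ k →
        Evaluates s (cosetBase hi) (λ j → proj₂ inners j hi) (proj₂ outers hi) fs)
      outers-correct = sequenceGen-correct (2 ℕ.^ k) outer n₂ (λ hi → Evaluates s (cosetBase hi) (λ j → proj₂ inners j hi)) (λ hi hi< n' n₂≤n' →
        rec-correct s (cosetBase hi) (λ j → proj₂ inners j hi) n' (ℕP.m^n>0 2 r) ℕP.≤-refl (ℕP.≤-trans (ℕP.<⇒≤ s<m) m≤nβ)
          (λ j j<b → ℕP.<-≤-trans (≡.subst (_ <_) |rs₂| (proj₁ (correct-exec {P = proj₁ inners} inners-correct rs₁ |rs₁| j j<b hi hi<))) n₂≤n'))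

    evaluate-correct : ∀ r → EvaluatorCorrect (evaluate r) r
    evaluate-correct zero (suc zero) a inF n _ _ _ inF< = evalBase-correct a inF n inF<
    evaluate-correct zero (suc (suc m)) a inF n _ (s≤s ()) _ _
    evaluate-correct (suc r) m a inF n 1≤m m≤2^[1+r] m≤nβ inF< = by-cases (2 ℕ.^ r <ᵇ m) ≡.refl
      where
      by-cases : ∀ split? → (2 ℕ.^ r <ᵇ m) ≡ split? →
        Correct (proj₁ (splitIf split? (evaluate r) r m a inF n)) n (Evaluates m a inF (proj₂ (splitIf split? (evaluate r) r m a inF n)))
      by-cases false eq = evaluate-correct r m a inF n 1≤m (<ᵇ-false⇒≥ eq) m≤nβ inF<
      by-cases true eq = evalSplit-correct (evaluate r) r (evaluate-correct r) m a inF n (<ᵇ-true⇒< eq) m≤2^[1+r] m≤nβ inF<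

pow2-ceiling : ∀ m → 1 ≤ m → Σ ℕ (λ r → (m ≤ 2 ℕ.^ r) × (2 ℕ.^ r < 2 ℕ.* m))
pow2-ceiling (suc zero) _ = 0 , s≤s z≤n , s≤s (s≤s z≤n)
pow2-ceiling (suc (suc m)) _ with pow2-ceiling (suc m) (s≤s z≤n)
... | r , m<2^r , 2^r<2m with suc (suc m) ℕP.≤? 2 ℕ.^ r
...   | yes m+1≤2^r = r , m+1≤2^r , ℕP.<-≤-trans 2^r<2m (ℕP.*-monoʳ-≤ 2 (ℕP.n≤1+n (suc m)))
...   | no m+1≰2^r = suc r ,
  ≡.subst (suc (suc m) ≤_) (≡.sym 2^[1+r]≡2m) (≡.subst (_≤ 2 ℕ.* suc m) (ℕP.+-comm (suc m) 1) (ℕP.+-monoʳ-≤ (suc m) (s≤s z≤n))) ,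
  ≡.subst (_< 2 ℕ.* suc (suc m)) (≡.sym 2^[1+r]≡2m) (ℕP.*-monoʳ-< 2 (ℕP.n<1+n (suc m)))
  where
  2^[1+r]≡2m : 2 ℕ.^ suc r ≡ 2 ℕ.* suc m
  2^[1+r]≡2m = ≡.cong (2 ℕ.*_) (ℕP.≤-antisym (ℕP.≤-pred (ℕP.≰⇒> m+1≰2^r)) m<2^r)

2^<2m⇒2^≤m*m : ∀ m r → 1 ≤ m → 2 ℕ.^ r < 2 ℕ.* m → 2 ℕ.^ r ≤ m ℕ.* m
2^<2m⇒2^≤m*m (suc zero) r _ 2^r<2 = ℕP.≤-pred 2^r<2
2^<2m⇒2^≤m*m (suc (suc m)) r _ 2^r<2m = ℕP.≤-trans (ℕP.<⇒≤ 2^r<2m) (ℕP.*-monoˡ-≤ (suc (suc m)) {2} {suc (suc m)} (s≤s (s≤s z≤n)))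

*-^-distrib : ∀ x y o → (x ℕ.* y) ℕ.^ o ≡ x ℕ.^ o ℕ.* y ℕ.^ o
*-^-distrib x y zero = ≡.refl
*-^-distrib x y (suc o) = ≡.trans (≡.cong (x ℕ.* y ℕ.*_) (*-^-distrib x y o)) (interchange x y (x ℕ.^ o) (y ℕ.^ o))
  where
  interchange : ∀ a b c d → a ℕ.* b ℕ.* (c ℕ.* d) ≡ a ℕ.* c ℕ.* (b ℕ.* d)
  interchange = solve-∀

square-cancel-≤ : ∀ x y → x ℕ.* x ≤ y ℕ.* y → x ≤ y
square-cancel-≤ x y x²≤y² with x ℕP.≤? y
... | yes x≤y = x≤y
... | no x≰y = ⊥-elim (ℕP.<⇒≱ (ℕP.*-mono-< (ℕP.≰⇒> x≰y) (ℕP.≰⇒> x≰y)) x²≤y²)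

-- With S = 2^m·m: 2(A − S) ≤ S·r, so 2^(2(A − S)) ≤ (2^r)^S ≤ (m²)^S = (m^S)².
atMostFFTBound : ∀ m r A → 2 ℕ.^ r ≤ m ℕ.* m → 2 ℕ.* A ≤ 2 ℕ.^ m ℕ.* m ℕ.* (2 ℕ.+ r) → AtMostFFTBound m A
atMostFFTBound m r A 2^r≤m² 2A≤ = square-cancel-≤ _ _ (begin
    2 ℕ.^ X ℕ.* 2 ℕ.^ X       ≡⟨ ≡.sym (ℕP.^-distribˡ-+-* 2 X X) ⟩
    2 ℕ.^ (X ℕ.+ X)           ≤⟨ ℕP.^-monoʳ-≤ 2 (≡.subst (_≤ S ℕ.* r) (2*≡+ X) 2X≤Tr) ⟩
    2 ℕ.^ (S ℕ.* r)           ≡⟨ ≡.cong (2 ℕ.^_) (ℕP.*-comm S r) ⟩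
    2 ℕ.^ (r ℕ.* S)           ≡⟨ ≡.sym (ℕP.^-*-assoc 2 r S) ⟩
    (2 ℕ.^ r) ℕ.^ S           ≤⟨ ℕP.^-monoˡ-≤ S 2^r≤m² ⟩
    (m ℕ.* m) ℕ.^ S           ≡⟨ *-^-distrib m m S ⟩
    m ℕ.^ S ℕ.* m ℕ.^ S       ∎)
  where
  open ℕP.≤-Reasoning
  S = 2 ℕ.^ m ℕ.* m
  X = A ∸ S
  2X≤Tr : 2 ℕ.* X ≤ S ℕ.* r
  2X≤Tr = begin
    2 ℕ.* (A ∸ S)                        ≡⟨ ℕP.*-distribˡ-∸ 2 A S ⟩
    2 ℕ.* A ∸ 2 ℕ.* S                    ≤⟨ ℕP.∸-monoˡ-≤ (2 ℕ.* S) 2A≤ ⟩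
    S ℕ.* (2 ℕ.+ r) ∸ 2 ℕ.* S            ≡⟨ ≡.cong (_∸ 2 ℕ.* S) (expand S r) ⟩
    2 ℕ.* S ℕ.+ S ℕ.* r ∸ 2 ℕ.* S        ≡⟨ ℕP.m+n∸m≡n (2 ℕ.* S) (S ℕ.* r) ⟩
    S ℕ.* r                              ∎
    where
    expand : ∀ S r → S ℕ.* (2 ℕ.+ r) ≡ 2 ℕ.* S ℕ.+ S ℕ.* r
    expand = solve-∀

open import Data.Nat using (_^_; _+_)

theorem2p8 : (L m : ℕ) → 1 ≤ L → 1 ≤ m → m ≤ 2 ^ L →
    (R : CommutativeRing 0ℓ 0ℓ) → IsField R → Char2 R →
    (β : ℕ → CommutativeRing.Carrier R) → IsCantorBasis R (2 ^ L) β →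
    (a : CommutativeRing.Carrier R) →
    InW R β (2 ^ L) a → ¬ InW R β m a →
    Σ (List (Instr R (2 ^ m))) λ P → Σ (Fin (2 ^ m) → ℕ) λ out →
      ((f : Fin (2 ^ m) → CommutativeRing.Carrier R) → (i : Fin (2 ^ m)) →
        CommutativeRing._≈_ R (reg R (run R P f) (out i))
          (evalPoly R (2 ^ m) f (CommutativeRing._+_ R a (varpi R (2 ^ L) β (toℕ i)))))
      × AtMostFFTBound m (additions R P)
theorem2p8 L m _ 1≤m m≤2^L R _ char2 β (_ , β0≈1 , β-step) a _ _ = P , out , correct , bound
  where
  open CommutativeRing R using (_≈_; trans; sym; +-congˡ)
  open CharTwo R char2 using (poly≈evalPoly; poly-cong; varpi-truncate)
  open Programs R (2 ^ m)
  open Evaluation R char2 (2 ^ m) β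
  r = proj₁ (pow2-ceiling m 1≤m)
  m≤2^r = proj₁ (proj₂ (pow2-ceiling m 1≤m))
  evaluation = evaluate r m a (λ j → j) (length (loadAll (λ j → j)))
  P = loadAll (λ j → j) ++ proj₁ evaluation
  out = λ i → proj₂ evaluation (toℕ i)
  correct : ∀ f i → reg R (run R P f) (out i) ≈ evalPoly R (2 ^ m) f (CommutativeRing._+_ R a (varpi R (2 ^ L) β (toℕ i)))
  correct f i = trans (proj₂ (evaluated (toℕ i) (FinP.toℕ<n i)))
      (trans (poly-cong (2 ^ m) (λ _ _ → CommutativeRing.refl R) (+-congˡ (sym (varpi-truncate m (2 ^ L) (toℕ i) β (FinP.toℕ<n i) m≤2^L))))
             (poly≈evalPoly (2 ^ m) f _ (λ j j< → CommutativeRing.reflexive R (loaded j j<)) _))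
    where
    open Semantics f
    post = correct-exec {P = P} (correct-++ {P = loadAll (λ j → j)} loadAll-correct
      (evaluate-correct f (2 ^ L) β0≈1 β-step r m a (λ j → j) _ 1≤m m≤2^r m≤2^L
        (λ j j< → ≡.subst (j <_) (≡.sym (LP.length-tabulate inp)) j<))) [] ≡.refl
    loaded = proj₁ post
    evaluated = proj₂ post
  loading-is-free : additions R P ≡ additions R (proj₁ evaluation)
  loading-is-free = ≡.trans (additions-++ (loadAll (λ j → j)) (proj₁ evaluation))
    (≡.cong (_+ additions R (proj₁ evaluation)) (loadAll-additions (λ j → j)))
  bound : AtMostFFTBound m (additions R P)
  bound = ≡.subst (AtMostFFTBound m) (≡.sym loading-is-free)
    (atMostFFTBound m r (additions R (proj₁ evaluation)) (2^<2m⇒2^≤m*m m r 1≤m (proj₂ (proj₂ (pow2-ceiling m 1≤m))))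
      (evaluate-additions r m a (λ j → j) (length (loadAll (λ j → j))) 1≤m m≤2^r))
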